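{- For any permutation $w\in S_n$, $\mathrm{fb}(w)=\mathrm{fb}(w_{\mathrm{sort}})$. If moreover $w$ is nonidentity and sorted with primary column data $(h,C,\alpha,i_1,\beta)$, then $\#\mathrm{fb}(ws_{i_1}s_{i_1-1}\cdots s_{\alpha+1})<\#\mathrm{fb}(w)$.
   Context: $[m,n]=\{m,\ldots,n\}$, $[0]=\emptyset$. $s_j$ adjacent transposition; permutations act on the right on positions ($ws_j$ is $w$ with $w(j),w(j+1)$ swapped). Rothe diagram $D(w)=\{(i,j)\in[n]^2: i<w^{ -1}(j),\ j<w(i)\}$ (row $i$, column $j$), columns $D(w)_j=\{i:(i,j)\in D(w)\}$. The set of fallen boxes $\mathrm{fb}(w)$ consists of those $(i,j)\in D(w)$ that are not top-aligned, i.e. for which some $(i',j)$ with $i'<i$ is not in $D(w)$. Standard interval: $[j]$, $j\ge0$. Dominant: all columns of $D(w)$ are standard intervals. Missing tooth of column $C$: $i\ge1$, $i\notin C$, $i+1\in C$. Primary column data: if $w$ not dominant, $h$ minimal with $D(w)_{h+1}$ not a standard interval, $C=D(w)_{h+1}$, $\alpha$ maximal with $[\alpha]\subseteq C$, $i_1$ smallest missing tooth of $C$, $\beta=i_1-\alpha$; if dominant, $(h,C,\alpha,i_1,\beta)=(n,\emptyset,0,n,n)$. $w$ maps $[\alpha+1,i_1]$ onto $[h-\beta+1,h]$; $\sigma(w)\in S_\beta$, $\sigma(w)(p)=w(\alpha+p)-(h-\beta)$; $w$ is sorted if $\sigma(w)$ is the identity. $w_{\mathrm{sort}}$ is obtained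 from $w$ by reordering the values $w(\alpha+1),\ldots,w(i_1)$ increasingly. -}

module Defs where

open import Data.Nat using (ℕ; zero; suc; _+_; _∸_; _≤_; _<_; _≤ᵇ_; _<ᵇ_; _≡ᵇ_)
open import Data.Nat.Properties using (≤-decTotalOrder)
open import Data.Bool using (Bool; true; false; _∧_; not; if_then_else_)
open import Data.List using (List; []; _∷_; map; upTo; concatMap)
open import Data.Bool.ListAction using (all; any)
open import Data.Nat.ListAction using (sum)
open import Data.Product using (_×_)
open import Relation.Binary.PropositionalEquality using (_≡_)
open import Data.List.Sort.InsertionSort ≤-decTotalOrder using (sort)

-- Conventions: a permutation w ∈ S_n is represented by a function ℕ → ℕ
-- (one-line notation, positions/values 1..n) that restricts to a
-- bijection of [1,n]; values outside [1,n] are irrelevant (never used).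

range : ℕ → ℕ → List ℕ
range a b = map (λ k → a + k) (upTo (suc b ∸ a))

inRange : ℕ → ℕ → Bool
inRange n i = (1 ≤ᵇ i) ∧ (i ≤ᵇ n)

IsPerm : ℕ → (ℕ → ℕ) → Set
IsPerm n w =
  (∀ i → 1 ≤ i → i ≤ n → (1 ≤ w i) × (w i ≤ n)) ×
  (∀ i j → 1 ≤ i → i ≤ n → 1 ≤ j → j ≤ n → w i ≡ w j → i ≡ j)

IsIdentity : ℕ → (ℕ → ℕ) → Set
IsIdentity n w = ∀ i → 1 ≤ i → i ≤ n → w i ≡ i

findFirst : (ℕ → Bool) → ℕ → List ℕ → ℕ
findFirst p d [] = d
findFirst p d (x ∷ xs) = if p x then x else findFirst p d xs

findLast : (ℕ → Bool) → ℕ → List ℕ → ℕ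
findLast p d [] = d
findLast p d (x ∷ xs) = if p x then findLast p x xs else findLast p d xs

inv : ℕ → (ℕ → ℕ) → ℕ → ℕ
inv n w j = findFirst (λ i → w i ≡ᵇ j) 0 (range 1 n)

-- Rothe diagram: (i,j) ∈ D(w) iff i,j ∈ [n], i < w⁻¹(j), j < w(i)
inD : ℕ → (ℕ → ℕ) → ℕ → ℕ → Bool
inD n w i j = inRange n i ∧ inRange n j ∧ (i <ᵇ inv n w j) ∧ (j <ᵇ w i)

inFB : ℕ → (ℕ → ℕ) → ℕ → ℕ → Bool
inFB n w i j = inD n w i j ∧ any (λ i' → not (inD n w i' j)) (range 1 (i ∸ 1))

countFB : ℕ → (ℕ → ℕ) → ℕ
countFB n w =
  sum (concatMap (λ i → map (λ j → if inFB n w i j then 1 else 0) (range 1 n)) (range 1 n))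

beq : Bool → Bool → Bool
beq a b = if a then b else not b

isStdCol : ℕ → (ℕ → ℕ) → ℕ → Bool
isStdCol n w j =
  any (λ k → all (λ i → beq (inD n w i j) (i ≤ᵇ k)) (range 1 n)) (range 0 n)

isDominant : ℕ → (ℕ → ℕ) → Bool
isDominant n w = all (isStdCol n w) (range 1 n)

-- Primary column data (h, C, α, i₁, β)
-- h : minimal with D(w)_{h+1} not a standard interval (n if dominant)
primH : ℕ → (ℕ → ℕ) → ℕ
primH n w = if isDominant n w then n
            else findFirst (λ j → not (isStdCol n w j)) (suc n) (range 1 n) ∸ 1

inC : ℕ → (ℕ → ℕ) → ℕ → Bool
inC n w i = if isDominant n w then false else inD n w i (suc (primH n w))

primα : ℕ → (ℕ → ℕ) → ℕ
primα n w = findLast (λ a → all (inC n w) (range 1 a)) 0 (range 0 n)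

primI1 : ℕ → (ℕ → ℕ) → ℕ
primI1 n w = if isDominant n w then n
             else findFirst (λ i → not (inC n w i) ∧ inC n w (suc i)) n (range 1 n)

primβ : ℕ → (ℕ → ℕ) → ℕ
primβ n w = primI1 n w ∸ primα n w

σ : ℕ → (ℕ → ℕ) → ℕ → ℕ
σ n w p = w (primα n w + p) ∸ (primH n w ∸ primβ n w)

IsSorted : ℕ → (ℕ → ℕ) → Set
IsSorted n w = ∀ p → 1 ≤ p → p ≤ primβ n w → σ n w p ≡ p

nth : List ℕ → ℕ → ℕ
nth [] _ = 0
nth (x ∷ xs) zero = x
nth (x ∷ xs) (suc k) = nth xs k

wsort : ℕ → (ℕ → ℕ) → (ℕ → ℕ)
wsort n w x =
  if (suc (primα n w) ≤ᵇ x) ∧ (x ≤ᵇ primI1 n w)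
  then nth (sort (map w (range (suc (primα n w)) (primI1 n w)))) (x ∸ suc (primα n w))
  else w x

swap : ℕ → ℕ → ℕ
swap j x = if x ≡ᵇ j then suc j else (if x ≡ᵇ suc j then j else x)

-- right multiplication w s_j (swap positions j, j+1)
mulS : (ℕ → ℕ) → ℕ → (ℕ → ℕ)
mulS w j x = w (swap j x)

-- w s_{a+m} s_{a+m-1} ⋯ s_{a+1}
mulDesc : (ℕ → ℕ) → ℕ → ℕ → (ℕ → ℕ)
mulDesc w a zero = w
mulDesc w a (suc m) = mulDesc (mulS w (a + suc m)) a m

wCycle : ℕ → (ℕ → ℕ) → (ℕ → ℕ)
wCycle n w = mulDesc w (primα n w) (primβ n w)

-- Whether a box of D(w) has fallen depends only on its column, so both parts are proved
-- column by column. Let (h, C, α, i₁, β) be the primary column data. Columns 1, …, h are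
-- top-aligned, the block values w(α+1), …, w(i₁) are at most h, and every value at most h
-- taken outside the block is smaller than all of them. Hence the columns indexed by block
-- values are top-aligned for both w and w_sort, and every other column is the same for the
-- two permutations.
--
-- If w is sorted, the block carries the values c+1, …, c+β with c = h − β, and
-- w' = w s_{i₁} ⋯ s_{α+1} moves w(i₁+1) to row α+1 and shifts the block down one row.
-- Columns c+1, …, c+β of w' are top-aligned; a column j > h whose dot lies below row i₁+1
-- changes only by raising its box in row i₁+1 to row α+1, which creates no fallen box
-- outside these two rows; every other column is unchanged. In column h+1 the raised box was
-- fallen (rows α+1, …, i₁ are empty) and no longer is (rows 1, …, α are full), so #fb drops.
-- In the dominant case a sorted w is the identity.

module Submission where

open import Defs
open import Data.Bool using (Bool; true; false; _∧_; not; if_then_else_)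
open import Data.Bool.Properties using (T-≡; ¬-not; not-¬; not-injective)
open import Data.Bool.ListAction using (all; any)
open import Data.Empty using (⊥; ⊥-elim)
open import Data.List using (List; []; _∷_; map; applyUpTo; upTo; concatMap; length)
open import Data.List.Properties using (map-upTo; length-map; length-upTo)
open import Data.List.Membership.Propositional.Properties using (∈-map⁺; ∈-map⁻)
open import Data.List.Relation.Binary.Permutation.Propositional using (↭-sym)
open import Data.List.Relation.Binary.Permutation.Propositional.Properties using (∈-resp-↭; ↭-length)
open import Data.List.Relation.Unary.AllPairs using (AllPairs; _∷_)
open import Data.List.Relation.Unary.Linked.Properties using (Linked⇒AllPairs)
open import Data.List.Membership.Propositional using (_∈_; find; lose)
import Data.List.Relation.Unary.All as All
open import Data.List.Relation.Unary.All.Properties using (all⁺; all⁻)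
open import Data.List.Relation.Unary.Any using (here; there)
open import Data.List.Relation.Unary.Any.Properties using (any⁺; any⁻)
open import Data.Nat
open import Data.Nat.Properties
open import Data.List.Sort.InsertionSort ≤-decTotalOrder using (sort)
open import Data.List.Sort.InsertionSort.Properties ≤-decTotalOrder using (sort-↭; sort-↗)
open import Algebra.Properties.CommutativeSemigroup +-commutativeSemigroup using (interchange; x∙yz≈yx∙z)
open import Data.Nat.ListAction using (sum)
open import Data.Nat.ListAction.Properties using (sum-++)
open import Data.Product using (∃; _×_; _,_; proj₁; proj₂)
open import Data.Sum using (_⊎_; inj₁; inj₂)
open import Function using (_∘_)
open import Function.Bundles using (Equivalence)
open import Relation.Nullary using (¬_; yes; no)
open import Relation.Binary.PropositionalEquality
open import Relation.Binary.Definitions using (tri<; tri≈; tri>)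

open Equivalence using (to; from)

∧-true⁻ : ∀ {a b} → a ∧ b ≡ true → a ≡ true × b ≡ true
∧-true⁻ {true} e = refl , e

∧-true : ∀ {a b} → a ≡ true → b ≡ true → a ∧ b ≡ true
∧-true refl refl = refl

Bool-ext : ∀ {a b} → (a ≡ true → b ≡ true) → (b ≡ true → a ≡ true) → a ≡ b
Bool-ext {true}           f _ = sym (f refl)
Bool-ext {false} {true}   _ g = g refl
Bool-ext {false} {false}  _ _ = refl

true-or-false : ∀ b → b ≡ true ⊎ b ≡ false
true-or-false true  = inj₁ refl
true-or-false false = inj₂ refl

if-true : ∀ {A : Set} {b} {x y : A} → b ≡ true → (if b then x else y) ≡ x
if-true refl = refl

if-false : ∀ {A : Set} {b} {x y : A} → b ≡ false → (if b then x else y) ≡ y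
if-false refl = refl

beq-true⁻ : ∀ {x y} → beq x y ≡ true → x ≡ y
beq-true⁻ {true}          e = sym e
beq-true⁻ {false} {false} _ = refl

beq-true : ∀ {x y} → x ≡ y → beq x y ≡ true
beq-true {true}  refl = refl
beq-true {false} refl = refl

≤ᵇ-true : ∀ {m n} → m ≤ n → (m ≤ᵇ n) ≡ true
≤ᵇ-true = to T-≡ ∘ ≤⇒≤ᵇ

≤ᵇ-true⁻ : ∀ {m n} → (m ≤ᵇ n) ≡ true → m ≤ n
≤ᵇ-true⁻ {m} {n} = ≤ᵇ⇒≤ m n ∘ from T-≡

<ᵇ-true : ∀ {m n} → m < n → (m <ᵇ n) ≡ true
<ᵇ-true = to T-≡ ∘ <⇒<ᵇ

<ᵇ-true⁻ : ∀ {m n} → (m <ᵇ n) ≡ true → m < n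
<ᵇ-true⁻ {m} {n} = <ᵇ⇒< m n ∘ from T-≡

≡ᵇ-true : ∀ {m n} → m ≡ n → (m ≡ᵇ n) ≡ true
≡ᵇ-true {m} {n} = to T-≡ ∘ ≡⇒≡ᵇ m n

≡ᵇ-true⁻ : ∀ {m n} → (m ≡ᵇ n) ≡ true → m ≡ n
≡ᵇ-true⁻ {m} {n} = ≡ᵇ⇒≡ m n ∘ from T-≡

≡ᵇ-false : ∀ {m n} → m ≢ n → (m ≡ᵇ n) ≡ false
≡ᵇ-false m≢n = ¬-not (m≢n ∘ ≡ᵇ-true⁻)

≤pred⇒< : ∀ {i' i} → 1 ≤ i' → i' ≤ pred i → i' < i
≤pred⇒< {i = suc i} _ i'≤i  = s≤s i'≤i
≤pred⇒< {i = zero} 1≤i' i'≤0 = ⊥-elim (<⇒≱ 1≤i' i'≤0)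

a<x≤a+k⇒x≡a+t : ∀ {a x k} → a < x → x ≤ a + k → ∃ λ t → 1 ≤ t × t ≤ k × x ≡ a + t
a<x≤a+k⇒x≡a+t {a} {x} {k} a<x x≤a+k =
  x ∸ a , m<n⇒0<n∸m a<x , ≤-trans (∸-monoˡ-≤ a x≤a+k) (≤-reflexive (m+n∸m≡n a k)) , sym (m+[n∸m]≡n (<⇒≤ a<x))

m∸n≡o⇒m≡n+o : ∀ {m n o} → 1 ≤ o → m ∸ n ≡ o → m ≡ n + o
m∸n≡o⇒m≡n+o {m} {n} 1≤o e = trans (sym (m+[n∸m]≡n n≤m)) (cong (n +_) e)
  where
  n≤m : n ≤ m
  n≤m = <⇒≤ (m∸n≢0⇒n<m λ m∸n≡0 → <⇒≱ 1≤o (≤-reflexive (trans (sym e) m∸n≡0)))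

-- Intervals and searches

interval : ℕ → ℕ → List ℕ
interval x zero    = []
interval x (suc k) = x ∷ interval (suc x) k

applyUpTo-interval : ∀ k {f : ℕ → ℕ} x → (∀ i → f i ≡ x + i) → applyUpTo f k ≡ interval x k
applyUpTo-interval zero    x f≗ = refl
applyUpTo-interval (suc k) x f≗ =
  cong₂ _∷_ (trans (f≗ 0) (+-identityʳ x)) (applyUpTo-interval k (suc x) (λ i → trans (f≗ (suc i)) (+-suc x i)))

range≡interval : ∀ a b → range a b ≡ interval a (suc b ∸ a)
range≡interval a b = trans (map-upTo (a +_) _) (applyUpTo-interval _ a (λ _ → refl))

∈-interval⁻ : ∀ {y} x k → y ∈ interval x k → x ≤ y × y < x + k
∈-interval⁻ x (suc k) (here refl) = ≤-refl , m<m+n x z<s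
∈-interval⁻ {y} x (suc k) (there y∈) with ∈-interval⁻ (suc x) k y∈
... | x<y , y<x+1+k = <⇒≤ x<y , subst (y <_) (sym (+-suc x k)) y<x+1+k

∈-interval⁺ : ∀ {y} x k → x ≤ y → y < x + k → y ∈ interval x k
∈-interval⁺ {y} x zero    x≤y y<x+0 = ⊥-elim (<⇒≱ y<x+0 (subst (_≤ y) (sym (+-identityʳ x)) x≤y))
∈-interval⁺ {y} x (suc k) x≤y y<x+1+k with m≤n⇒m<n∨m≡n x≤y
... | inj₂ refl = here refl
... | inj₁ x<y  = there (∈-interval⁺ (suc x) k x<y (subst (y <_) (+-suc x k) y<x+1+k))

≤⇒<+[suc∸] : ∀ {a b y} → a ≤ y → y ≤ b → y < a + (suc b ∸ a)
≤⇒<+[suc∸] {y = y} a≤y y≤b = subst (y <_) (sym (m+[n∸m]≡n (≤-trans a≤y (m≤n⇒m≤1+n y≤b)))) (s≤s y≤b)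

<+[suc∸]⇒≤ : ∀ {a b y} → a ≤ y → y < a + (suc b ∸ a) → y ≤ b
<+[suc∸]⇒≤ {a} {b} {y} a≤y y< with a ≤? suc b
... | yes a≤1+b = s≤s⁻¹ (subst (y <_) (m+[n∸m]≡n a≤1+b) y<)
... | no  a≰1+b = ⊥-elim (<⇒≱ (subst (y <_) (trans (cong (a +_) (m≤n⇒m∸n≡0 (≰⇒≥ a≰1+b))) (+-identityʳ a)) y<) a≤y)

∈-range⁻ : ∀ {y} a b → y ∈ range a b → a ≤ y × y ≤ b
∈-range⁻ {y} a b y∈ with ∈-interval⁻ a _ (subst (y ∈_) (range≡interval a b) y∈)
... | a≤y , y< = a≤y , <+[suc∸]⇒≤ a≤y y<

∈-range⁺ : ∀ {y} a b → a ≤ y → y ≤ b → y ∈ range a b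
∈-range⁺ {y} a b a≤y y≤b = subst (y ∈_) (sym (range≡interval a b)) (∈-interval⁺ a _ a≤y (≤⇒<+[suc∸] a≤y y≤b))

module _ (p : ℕ → Bool) (a b : ℕ) where

  any-range⁺ : ∀ y → a ≤ y → y ≤ b → p y ≡ true → any p (range a b) ≡ true
  any-range⁺ y a≤y y≤b py = to T-≡ (any⁺ p (lose (∈-range⁺ a b a≤y y≤b) (from T-≡ py)))

  any-range⁻ : any p (range a b) ≡ true → ∃ λ y → a ≤ y × y ≤ b × p y ≡ true
  any-range⁻ e with find (any⁻ p (range a b) (from T-≡ e))
  ... | y , y∈ , py = let a≤y , y≤b = ∈-range⁻ a b y∈ in y , a≤y , y≤b , to T-≡ py

  all-range⁺ : (∀ y → a ≤ y → y ≤ b → p y ≡ true) → all p (range a b) ≡ true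
  all-range⁺ h = to T-≡ (all⁻ p (All.tabulate λ y∈ →
    let a≤y , y≤b = ∈-range⁻ a b y∈ in from T-≡ (h _ a≤y y≤b)))

  all-range⁻ : all p (range a b) ≡ true → ∀ y → a ≤ y → y ≤ b → p y ≡ true
  all-range⁻ e y a≤y y≤b = to T-≡ (All.lookup (all⁺ p (range a b) (from T-≡ e)) (∈-range⁺ a b a≤y y≤b))

NoneIn : (ℕ → Bool) → ℕ → ℕ → Set
NoneIn p a b = ∀ z → a ≤ z → z ≤ b → p z ≡ false

record LeastIn (p : ℕ → Bool) (a b y : ℕ) : Set where
  field
    lower : a ≤ y
    upper : y ≤ b
    holds : p y ≡ true
    least : ∀ z → a ≤ z → z < y → p z ≡ false

LeastIn-unique : ∀ {p a b y y'} → LeastIn p a b y → LeastIn p a b y' → y ≡ y'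
LeastIn-unique {y = y} {y'} l l' with <-cmp y y'
... | tri< y<y' _ _ = ⊥-elim (not-¬ (LeastIn.holds l) (LeastIn.least l' y (LeastIn.lower l) y<y'))
... | tri≈ _ y≡y' _ = y≡y'
... | tri> _ _ y'<y = ⊥-elim (not-¬ (LeastIn.holds l') (LeastIn.least l y' (LeastIn.lower l') y'<y))

findFirst-interval : ∀ p d x k →
  (∃ λ y → x ≤ y × y < x + k × p y ≡ true × (∀ z → x ≤ z → z < y → p z ≡ false) × findFirst p d (interval x k) ≡ y)
  ⊎ ((∀ z → x ≤ z → z < x + k → p z ≡ false) × findFirst p d (interval x k) ≡ d)
findFirst-interval p d x zero =
  inj₂ ((λ z x≤z z<x+0 → ⊥-elim (<⇒≱ z<x+0 (subst (_≤ z) (sym (+-identityʳ x)) x≤z))) , refl)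
findFirst-interval p d x (suc k) with p x in px
... | true = inj₁ (x , ≤-refl , m<m+n x z<s , px , (λ z x≤z z<x → ⊥-elim (<⇒≱ z<x x≤z)) , refl)
... | false with findFirst-interval p d (suc x) k
...   | inj₁ (y , x<y , y< , py , least , eq) =
          inj₁ (y , <⇒≤ x<y , subst (y <_) (sym (+-suc x k)) y< , py , extend least , eq)
  where
  extend : (∀ z → suc x ≤ z → z < y → p z ≡ false) → ∀ z → x ≤ z → z < y → p z ≡ false
  extend h z x≤z z<y with m≤n⇒m<n∨m≡n x≤z
  ... | inj₂ refl = px
  ... | inj₁ x<z  = h z x<z z<y
...   | inj₂ (none , eq) = inj₂ (extend , eq)
  where
  extend : ∀ z → x ≤ z → z < x + suc k → p z ≡ false
  extend z x≤z z< with m≤n⇒m<n∨m≡n x≤z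
  ... | inj₂ refl = px
  ... | inj₁ x<z  = none z x<z (subst (z <_) (+-suc x k) z<)

findFirst-range : ∀ p d a b →
  LeastIn p a b (findFirst p d (range a b)) ⊎ (NoneIn p a b × findFirst p d (range a b) ≡ d)
findFirst-range p d a b rewrite range≡interval a b with findFirst-interval p d a (suc b ∸ a)
... | inj₁ (y , a≤y , y< , py , least , refl) =
  inj₁ (record { lower = a≤y ; upper = <+[suc∸]⇒≤ a≤y y< ; holds = py ; least = least })
... | inj₂ (none , eq) = inj₂ ((λ z a≤z z≤b → none z a≤z (≤⇒<+[suc∸] a≤z z≤b)) , eq)

findFirst-range-least : ∀ {p a b y} d → LeastIn p a b y → findFirst p d (range a b) ≡ y
findFirst-range-least {p} {a} {b} d l with findFirst-range p d a b
... | inj₁ l'          = LeastIn-unique l' l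
... | inj₂ (none , _)  = ⊥-elim (not-¬ (LeastIn.holds l) (none _ (LeastIn.lower l) (LeastIn.upper l)))

findFirst-range-none : ∀ {p a b} d → NoneIn p a b → findFirst p d (range a b) ≡ d
findFirst-range-none {p} {a} {b} d none with findFirst-range p d a b
... | inj₁ l        = ⊥-elim (not-¬ (LeastIn.holds l) (none _ (LeastIn.lower l) (LeastIn.upper l)))
... | inj₂ (_ , eq) = eq

findLast-interval : ∀ p d x k → p d ≡ true → d < x →
  let r = findLast p d (interval x k) in
  p r ≡ true × d ≤ r × r < x + k × (∀ z → x ≤ z → z < x + k → r < z → p z ≡ false)
findLast-interval p d x zero pd d<x =
  pd , ≤-refl , subst (d <_) (sym (+-identityʳ x)) d<x ,
  (λ z x≤z z<x+0 _ → ⊥-elim (<⇒≱ z<x+0 (subst (_≤ z) (sym (+-identityʳ x)) x≤z)))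
findLast-interval p d x (suc k) pd d<x with p x in px
... | true with findLast-interval p x (suc x) k px ≤-refl
...   | pr , x≤r , r< , last =
          pr , ≤-trans (<⇒≤ d<x) x≤r , subst (findLast p x (interval (suc x) k) <_) (sym (+-suc x k)) r< , extend
  where
  extend : ∀ z → x ≤ z → z < x + suc k → findLast p x (interval (suc x) k) < z → p z ≡ false
  extend z x≤z z< r<z with m≤n⇒m<n∨m≡n x≤z
  ... | inj₂ refl = ⊥-elim (<⇒≱ r<z x≤r)
  ... | inj₁ x<z  = last z x<z (subst (z <_) (+-suc x k) z<) r<z
findLast-interval p d x (suc k) pd d<x | false with findLast-interval p d (suc x) k pd (m<n⇒m<1+n d<x)
...   | pr , d≤r , r< , last =
          pr , d≤r , subst (findLast p d (interval (suc x) k) <_) (sym (+-suc x k)) r< , extend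
  where
  extend : ∀ z → x ≤ z → z < x + suc k → findLast p d (interval (suc x) k) < z → p z ≡ false
  extend z x≤z z< r<z with m≤n⇒m<n∨m≡n x≤z
  ... | inj₂ refl = px
  ... | inj₁ x<z  = last z x<z (subst (z <_) (+-suc x k) z<) r<z

findLast-range-0≡interval-1 : ∀ p n → p 0 ≡ true → findLast p 0 (range 0 n) ≡ findLast p 0 (interval 1 n)
findLast-range-0≡interval-1 p n p0 = trans (cong (findLast p 0) (range≡interval 0 n)) skip-0
  where
  skip-0 : findLast p 0 (interval 0 (suc n)) ≡ findLast p 0 (interval 1 n)
  skip-0 rewrite p0 = refl

findLast-range-from-0 : ∀ p n → p 0 ≡ true →
  let r = findLast p 0 (range 0 n) in p r ≡ true × r ≤ n × (∀ z → z ≤ n → r < z → p z ≡ false)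
findLast-range-from-0 p n p0 rewrite findLast-range-0≡interval-1 p n p0 with findLast-interval p 0 1 n p0 z<s
... | pr , _ , r<1+n , last = pr , s≤s⁻¹ r<1+n , λ z z≤n r<z → last z (≤-trans z<s r<z) (s≤s z≤n) r<z

-- Rothe diagrams

InjectiveOn : ℕ → (ℕ → ℕ) → Set
InjectiveOn n w = ∀ i j → 1 ≤ i → i ≤ n → 1 ≤ j → j ≤ n → w i ≡ w j → i ≡ j

module _ {n : ℕ} {w : ℕ → ℕ} where

  inv-least : ∀ {j k} → 1 ≤ k → k ≤ n → w k ≡ j → (∀ i → 1 ≤ i → i < k → w i ≢ j) → inv n w j ≡ k
  inv-least 1≤k k≤n wk≡j earlier = findFirst-range-least 0 record
    { lower = 1≤k ; upper = k≤n ; holds = ≡ᵇ-true wk≡j ; least = λ i 1≤i i<k → ≡ᵇ-false (earlier i 1≤i i<k) }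

  inv-absent : ∀ {j} → (∀ i → 1 ≤ i → i ≤ n → w i ≢ j) → inv n w j ≡ 0
  inv-absent absent = findFirst-range-none 0 (λ i 1≤i i≤n → ≡ᵇ-false (absent i 1≤i i≤n))

  inv-cases : ∀ j → (inv n w j ≡ 0 × (∀ i → 1 ≤ i → i ≤ n → w i ≢ j))
                  ⊎ (1 ≤ inv n w j × inv n w j ≤ n × w (inv n w j) ≡ j)
  inv-cases j with findFirst-range (λ i → w i ≡ᵇ j) 0 1 n
  ... | inj₁ l           = inj₂ (LeastIn.lower l , LeastIn.upper l , ≡ᵇ-true⁻ (LeastIn.holds l))
  ... | inj₂ (none , eq) = inj₁ (eq , λ i 1≤i i≤n wi≡j → not-¬ (≡ᵇ-true wi≡j) (none i 1≤i i≤n))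

  inv-value : InjectiveOn n w → ∀ {k} → 1 ≤ k → k ≤ n → inv n w (w k) ≡ k
  inv-value inj {k} 1≤k k≤n = inv-least 1≤k k≤n refl
    (λ i 1≤i i<k wi≡wk → <⇒≢ i<k (inj i k 1≤i (≤-trans (<⇒≤ i<k) k≤n) 1≤k k≤n wi≡wk))

record Box (n : ℕ) (w : ℕ → ℕ) (i j : ℕ) : Set where
  constructor box
  field
    row≥1   : 1 ≤ i
    row≤n   : i ≤ n
    col≥1   : 1 ≤ j
    col≤n   : j ≤ n
    row<inv : i < inv n w j
    col<w   : j < w i

module _ (n : ℕ) (w : ℕ → ℕ) (i j : ℕ) where

  box⁻ : inD n w i j ≡ true → Box n w i j
  box⁻ e =
    let inRangeᵢ , rest = ∧-true⁻ e ; inRangeⱼ , dot = ∧-true⁻ rest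
        1≤i , i≤n = ∧-true⁻ inRangeᵢ ; 1≤j , j≤n = ∧-true⁻ inRangeⱼ ; i<inv , j<wi = ∧-true⁻ dot
    in box (≤ᵇ-true⁻ 1≤i) (≤ᵇ-true⁻ i≤n) (≤ᵇ-true⁻ 1≤j) (≤ᵇ-true⁻ j≤n) (<ᵇ-true⁻ i<inv) (<ᵇ-true⁻ j<wi)

  box⁺ : Box n w i j → inD n w i j ≡ true
  box⁺ (box 1≤i i≤n 1≤j j≤n i<inv j<wi) =
    ∧-true (∧-true (≤ᵇ-true 1≤i) (≤ᵇ-true i≤n))
           (∧-true (∧-true (≤ᵇ-true 1≤j) (≤ᵇ-true j≤n)) (∧-true (<ᵇ-true i<inv) (<ᵇ-true j<wi)))

  no-box : ¬ Box n w i j → inD n w i j ≡ false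
  no-box ¬box = ¬-not (¬box ∘ box⁻)

inD-transfer : ∀ {n f g i j} → (i < inv n f j → j < f i → i < inv n g j × j < g i) →
               inD n f i j ≡ true → inD n g i j ≡ true
inD-transfer {n} {f} {g} {i} {j} h e = let b = box⁻ n f i j e ; i<inv , j<gi = h (Box.row<inv b) (Box.col<w b) in
  box⁺ n g i j (box (Box.row≥1 b) (Box.row≤n b) (Box.col≥1 b) (Box.col≤n b) i<inv j<gi)

module _ (n : ℕ) (f g : ℕ → ℕ) (i j : ℕ) where

  inD-≡ : (i < inv n f j → j < f i → i < inv n g j × j < g i) →
          (i < inv n g j → j < g i → i < inv n f j × j < f i) → inD n f i j ≡ inD n g i j
  inD-≡ f⇒g g⇒f = Bool-ext (inD-transfer {n} {f} {g} f⇒g) (inD-transfer {n} {g} {f} g⇒f)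

  inD-cong : inv n f j ≡ inv n g j → f i ≡ g i → inD n f i j ≡ inD n g i j
  inD-cong inv≡ fi≡gi = inD-≡ (λ i< j< → subst (i <_) inv≡ i< , subst (j <_) fi≡gi j<)
                              (λ i< j< → subst (i <_) (sym inv≡) i< , subst (j <_) (sym fi≡gi) j<)

inD-below-dot : ∀ n f i j → inv n f j ≤ i → inD n f i j ≡ false
inD-below-dot n f i j inv≤i = no-box n f i j (λ b → <⇒≱ (Box.row<inv b) inv≤i)

-- Counting fallen boxes

indicator : Bool → ℕ
indicator b = if b then 1 else 0

indicator-mono : ∀ {a b} → (a ≡ true → b ≡ true) → indicator a ≤ indicator b
indicator-mono {false} _   = z≤n
indicator-mono {true}  a⇒b rewrite a⇒b refl = ≤-refl

sum-concatMap : ∀ (f : ℕ → List ℕ) xs → sum (concatMap f xs) ≡ sum (map (sum ∘ f) xs)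
sum-concatMap f []       = refl
sum-concatMap f (x ∷ xs) = trans (sum-++ (f x) (concatMap f xs)) (cong (sum (f x) +_) (sum-concatMap f xs))

sum-map-+ : ∀ (f g : ℕ → ℕ) xs → sum (map (λ x → f x + g x) xs) ≡ sum (map f xs) + sum (map g xs)
sum-map-+ f g []       = refl
sum-map-+ f g (x ∷ xs) rewrite sum-map-+ f g xs = interchange (f x) (g x) (sum (map f xs)) (sum (map g xs))

sum-map-mono-≤ : ∀ {f g : ℕ → ℕ} xs → (∀ {x} → x ∈ xs → f x ≤ g x) → sum (map f xs) ≤ sum (map g xs)
sum-map-mono-≤ []       f≤g = ≤-refl
sum-map-mono-≤ (x ∷ xs) f≤g = +-mono-≤ (f≤g (here refl)) (sum-map-mono-≤ xs (f≤g ∘ there))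

sum-map-mono-< : ∀ {f g : ℕ → ℕ} {y} xs → (∀ {x} → x ∈ xs → f x ≤ g x) → y ∈ xs → f y < g y →
                 sum (map f xs) < sum (map g xs)
sum-map-mono-< (x ∷ xs) f≤g (here refl) fy<gy = +-mono-<-≤ fy<gy (sum-map-mono-≤ xs (f≤g ∘ there))
sum-map-mono-< (x ∷ xs) f≤g (there y∈)  fy<gy =
  +-mono-≤-< (f≤g (here refl)) (sum-map-mono-< xs (f≤g ∘ there) y∈ fy<gy)

module _ {f g : ℕ → ℕ} where

  private
    Σ[_] : (ℕ → ℕ) → ℕ → ℕ → ℕ
    Σ[ h ] x k = sum (map h (interval x k))

  sum-interval-<-offset : ∀ x k {q} A B → q ∈ interval x k → (∀ i → i ∈ interval x k → i ≢ q → f i ≤ g i) →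
                          A + f q < B + g q → A + Σ[ f ] x k < B + Σ[ g ] x k
  sum-interval-<-offset x (suc k) A B (here refl) f≤g Afq<Bgq =
    subst₂ _<_ (+-assoc A (f x) _) (+-assoc B (g x) _)
      (+-mono-<-≤ Afq<Bgq (sum-map-mono-≤ (interval (suc x) k) λ {i} i∈ →
        f≤g i (there i∈) (λ i≡x → <-irrefl (sym i≡x) (proj₁ (∈-interval⁻ (suc x) k i∈)))))
  sum-interval-<-offset x (suc k) {q} A B (there q∈) f≤g Afq<Bgq =
    subst₂ _<_ (+-assoc A (f x) _) (+-assoc B (g x) _)
      (sum-interval-<-offset (suc x) k (A + f x) (B + g x) q∈ (λ i i∈ → f≤g i (there i∈))
        (subst₂ _<_ (x∙yz≈yx∙z (f x) A (f q)) (x∙yz≈yx∙z (g x) B (g q))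
          (+-mono-≤-< (f≤g x (here refl) x≢q) Afq<Bgq)))
    where
    x≢q : x ≢ q
    x≢q x≡q = <-irrefl x≡q (proj₁ (∈-interval⁻ (suc x) k q∈))

  sum-interval-<-pair : ∀ x k {p q} → p ∈ interval x k → q ∈ interval x k → p < q →
    (∀ i → i ∈ interval x k → i ≢ p → i ≢ q → f i ≤ g i) → f p + f q < g p + g q →
    Σ[ f ] x k < Σ[ g ] x k
  sum-interval-<-pair x (suc k) (here refl) (here refl) p<q f≤g fpq<gpq = ⊥-elim (<-irrefl refl p<q)
  sum-interval-<-pair x (suc k) (here refl) (there q∈) p<q f≤g fpq<gpq =
    sum-interval-<-offset (suc x) k (f x) (g x) q∈
      (λ i i∈ i≢q → f≤g i (there i∈) (λ i≡x → <-irrefl (sym i≡x) (proj₁ (∈-interval⁻ (suc x) k i∈))) i≢q) fpq<gpq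
  sum-interval-<-pair x (suc k) (there p∈) (here refl) p<q f≤g fpq<gpq =
    ⊥-elim (<-asym p<q (proj₁ (∈-interval⁻ (suc x) k p∈)))
  sum-interval-<-pair x (suc k) {p} {q} (there p∈) (there q∈) p<q f≤g fpq<gpq =
    +-mono-≤-< (f≤g x (here refl) (x≢ p∈) (x≢ q∈))
      (sum-interval-<-pair (suc x) k p∈ q∈ p<q (λ i i∈ → f≤g i (there i∈)) fpq<gpq)
    where
    x≢ : ∀ {y} → y ∈ interval (suc x) k → x ≢ y
    x≢ y∈ x≡y = <-irrefl x≡y (proj₁ (∈-interval⁻ (suc x) k y∈))

rowFB : ℕ → (ℕ → ℕ) → ℕ → ℕ
rowFB n w i = sum (map (λ j → indicator (inFB n w i j)) (interval 1 n))

countFB≡sum-rowFB : ∀ n w → countFB n w ≡ sum (map (rowFB n w) (interval 1 n))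
countFB≡sum-rowFB n w rewrite sum-concatMap (λ i → map (λ j → indicator (inFB n w i j)) (range 1 n)) (range 1 n)
                            | range≡interval 1 n = refl

pairFB : ℕ → (ℕ → ℕ) → ℕ → ℕ → ℕ → ℕ
pairFB n w p q j = indicator (inFB n w p j) + indicator (inFB n w q j)

countFB-< : ∀ n w w' {p q} → 1 ≤ p → p < q → q ≤ n →
  (∀ i j → i ≢ p → i ≢ q → inFB n w' i j ≡ true → inFB n w i j ≡ true) →
  (∀ j → pairFB n w' p q j ≤ pairFB n w p q j) →
  ∀ {j₀} → 1 ≤ j₀ → j₀ ≤ n → pairFB n w' p q j₀ < pairFB n w p q j₀ →
  countFB n w' < countFB n w
countFB-< n w w' {p} {q} 1≤p p<q q≤n off-pq pair {j₀} 1≤j₀ j₀≤n strict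
  rewrite countFB≡sum-rowFB n w | countFB≡sum-rowFB n w' =
  sum-interval-<-pair 1 n (∈-interval⁺ 1 n 1≤p (s≤s (≤-trans (<⇒≤ p<q) q≤n)))
    (∈-interval⁺ 1 n (≤-trans 1≤p (<⇒≤ p<q)) (s≤s q≤n)) p<q
    (λ i _ i≢p i≢q → sum-map-mono-≤ (interval 1 n) λ {j} _ → indicator-mono (off-pq i j i≢p i≢q))
    (subst₂ _<_ (sum-map-+ (ind w' p) (ind w' q) (interval 1 n)) (sum-map-+ (ind w p) (ind w q) (interval 1 n))
      (sum-map-mono-< (interval 1 n) (λ {j} _ → pair j) (∈-interval⁺ 1 n 1≤j₀ (s≤s j₀≤n)) strict))
  where
  ind : (ℕ → ℕ) → ℕ → ℕ → ℕ
  ind v i j = indicator (inFB n v i j)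

-- Fallen boxes of a single column

column : ℕ → (ℕ → ℕ) → ℕ → ℕ → Bool
column n w j i = inD n w i j

-- inFB n w i j is definitionally fallen (column n w j) i.
fallen : (ℕ → Bool) → ℕ → Bool
fallen c i = c i ∧ any (λ i' → not (c i')) (range 1 (i ∸ 1))

record Gap (c : ℕ → Bool) (i : ℕ) : Set where
  constructor gap
  field
    row   : ℕ
    row≥1 : 1 ≤ row
    row<i : row < i
    empty : c row ≡ false

TopAligned : (ℕ → Bool) → Set
TopAligned c = ∀ i i' → 1 ≤ i' → i' ≤ i → c i ≡ true → c i' ≡ true

module _ (c : ℕ → Bool) (i : ℕ) where

  fallen⁻ : fallen c i ≡ true → c i ≡ true × Gap c i
  fallen⁻ e with ∧-true⁻ e
  ... | ci , some with any-range⁻ (λ i' → not (c i')) 1 (i ∸ 1) some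
  ...   | i' , 1≤i' , i'≤i-1 , ¬ci' = ci , gap i' 1≤i' (≤pred⇒< 1≤i' i'≤i-1) (not-injective ¬ci')

  fallen⁺ : c i ≡ true → Gap c i → fallen c i ≡ true
  fallen⁺ ci (gap i' 1≤i' i'<i ci') =
    ∧-true ci (any-range⁺ (λ i' → not (c i')) 1 (i ∸ 1) i' 1≤i' (<⇒≤pred i'<i) (cong not ci'))

  top-aligned⇒¬fallen : TopAligned c → fallen c i ≡ false
  top-aligned⇒¬fallen top = ¬-not λ e → let ci , gap i' 1≤i' i'<i ci' = fallen⁻ e in
    not-¬ (top i i' 1≤i' (<⇒≤ i'<i) ci) ci'

fallen-cong : ∀ {c c'} → (∀ i → c i ≡ c' i) → ∀ i → fallen c i ≡ fallen c' i
fallen-cong {c} {c'} c≗c' i = Bool-ext (transfer c c' c≗c') (transfer c' c (sym ∘ c≗c'))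
  where
  transfer : ∀ d d' → (∀ i → d i ≡ d' i) → fallen d i ≡ true → fallen d' i ≡ true
  transfer d d' d≗d' e = let di , gap i' 1≤i' i'<i di' = fallen⁻ d i e in
    fallen⁺ d' i (trans (sym (d≗d' i)) di) (gap i' 1≤i' i'<i (trans (sym (d≗d' i')) di'))

module RaisedBox (c c' : ℕ → Bool) {p q : ℕ} (1≤p : 1 ≤ p) (p<q : p < q)
  (same-above : ∀ i → i < p → c' i ≡ c i) (same-below : ∀ i → q < i → c' i ≡ c i)
  (empty-from-p : ∀ i → p ≤ i → i < q → c i ≡ false) (empty-to-q : ∀ i → p < i → i ≤ q → c' i ≡ false)
  (moved : c' p ≡ c q) where

  fallen-off-pq : ∀ i → i ≢ p → i ≢ q → fallen c' i ≡ true → fallen c i ≡ true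
  fallen-off-pq i i≢p i≢q e with fallen⁻ c' i e
  ... | c'i , gap i' 1≤i' i'<i c'i' with <-cmp i p
  ...   | tri< i<p _ _ = fallen⁺ c i (trans (sym (same-above i i<p)) c'i)
                           (gap i' 1≤i' i'<i (trans (sym (same-above i' (<-trans i'<i i<p))) c'i'))
  ...   | tri≈ _ i≡p _ = ⊥-elim (i≢p i≡p)
  ...   | tri> _ _ p<i with <-cmp i q
  ...     | tri< i<q _ _ = ⊥-elim (not-¬ c'i (empty-to-q i p<i (<⇒≤ i<q)))
  ...     | tri≈ _ i≡q _ = ⊥-elim (i≢q i≡q)
  ...     | tri> _ _ q<i = fallen⁺ c i (trans (sym (same-below i q<i)) c'i)
                             (gap p 1≤p (<-trans p<q q<i) (empty-from-p p ≤-refl p<q))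

  ¬fallen-p : fallen c p ≡ false
  ¬fallen-p = ¬-not λ e → not-¬ (proj₁ (fallen⁻ c p e)) (empty-from-p p ≤-refl p<q)

  ¬fallen'-q : fallen c' q ≡ false
  ¬fallen'-q = ¬-not λ e → not-¬ (proj₁ (fallen⁻ c' q e)) (empty-to-q q p<q ≤-refl)

  fallen-q : c q ≡ true → fallen c q ≡ true
  fallen-q cq = fallen⁺ c q cq (gap p 1≤p p<q (empty-from-p p ≤-refl p<q))

  pair-≤ : indicator (fallen c' p) + indicator (fallen c' q) ≤ indicator (fallen c p) + indicator (fallen c q)
  pair-≤ rewrite ¬fallen-p | ¬fallen'-q =
    subst (_≤ indicator (fallen c q)) (sym (+-identityʳ _))
      (indicator-mono λ e → fallen-q (trans (sym moved) (proj₁ (fallen⁻ c' p e))))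

  ¬fallen'-p : (∀ i → 1 ≤ i → i < p → c i ≡ true) → fallen c' p ≡ false
  ¬fallen'-p full-above = ¬-not λ e → let _ , gap i' 1≤i' i'<p c'i' = fallen⁻ c' p e in
    not-¬ (trans (same-above i' i'<p) (full-above i' 1≤i' i'<p)) c'i'

  pair-< : (∀ i → 1 ≤ i → i < p → c i ≡ true) → c q ≡ true →
           indicator (fallen c' p) + indicator (fallen c' q) < indicator (fallen c p) + indicator (fallen c q)
  pair-< full-above cq rewrite ¬fallen-p | ¬fallen'-q | fallen-q cq | ¬fallen'-p full-above = s≤s z≤n

-- Sorting the block

nth-∈ : ∀ xs {t} → t < length xs → nth xs t ∈ xs
nth-∈ (x ∷ xs) {zero}  _        = here refl
nth-∈ (x ∷ xs) {suc t} (s≤s t<) = there (nth-∈ xs t<)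

∈⇒first-index : ∀ {y} xs → y ∈ xs → ∃ λ t → t < length xs × nth xs t ≡ y × (∀ t' → t' < t → nth xs t' ≢ y)
∈⇒first-index {y} (x ∷ xs) y∈ with x ≟ y
... | yes x≡y = 0 , z<s , x≡y , λ _ ()
... | no x≢y with y∈
...   | here y≡x = ⊥-elim (x≢y (sym y≡x))
...   | there y∈xs with ∈⇒first-index xs y∈xs
...     | t , t< , nth≡y , first = suc t , s≤s t< , nth≡y , earlier
  where
  earlier : ∀ t' → t' < suc t → nth (x ∷ xs) t' ≢ y
  earlier zero     _          = x≢y
  earlier (suc t') (s≤s t'<t) = first t' t'<t

AllPairs-nth-mono : ∀ {xs} → AllPairs _≤_ xs → ∀ {t' t} → t' ≤ t → t < length xs → nth xs t' ≤ nth xs t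
AllPairs-nth-mono {x ∷ xs} _             {zero}   {zero}  _           _        = ≤-refl
AllPairs-nth-mono {x ∷ xs} (x≤xs ∷ _)    {zero}   {suc t} _           (s≤s t<) = All.lookup x≤xs (nth-∈ xs t<)
AllPairs-nth-mono {x ∷ xs} (_ ∷ ordered) {suc t'} {suc t} (s≤s t'≤t) (s≤s t<) = AllPairs-nth-mono ordered t'≤t t<

-- With a = α and b = i₁, ws is wsort n w.
module Sorting (n : ℕ) (w : ℕ → ℕ) (perm : IsPerm n w) (a b h : ℕ) (b≤n : b ≤ n)
  (block≤h : ∀ x → a < x → x ≤ b → w x ≤ h)
  (h<prefix : ∀ i → 1 ≤ i → i ≤ a → h < w i)
  (top-aligned≤h : ∀ j → 1 ≤ j → j ≤ h → TopAligned (column n w j))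
  (low-below-block : ∀ k → 1 ≤ k → k ≤ n → w k ≤ h → k ≤ a ⊎ b < k → ∀ r → a < r → r ≤ b → w k < w r) where

  private
    w-inj : InjectiveOn n w
    w-inj = proj₂ perm

  values : List ℕ
  values = map w (range (suc a) b)

  sorted : List ℕ
  sorted = sort values

  ws : ℕ → ℕ
  ws x = if (suc a ≤ᵇ x) ∧ (x ≤ᵇ b) then nth sorted (x ∸ suc a) else w x

  length-sorted : length sorted ≡ b ∸ a
  length-sorted = trans (↭-length (sort-↭ values))
    (trans (length-map w (range (suc a) b)) (trans (length-map (suc a +_) (upTo (b ∸ a))) (length-upTo (b ∸ a))))

  BlockValue : ℕ → Set
  BlockValue j = ∃ λ r → a < r × r ≤ b × w r ≡ j

  sorted-entry : ∀ {t} → t < b ∸ a → BlockValue (nth sorted t)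
  sorted-entry t< with ∈-map⁻ w (∈-resp-↭ (sort-↭ values) (nth-∈ sorted (subst (_ <_) (sym length-sorted) t<)))
  ... | r , r∈ , e = let a<r , r≤b = ∈-range⁻ (suc a) b r∈ in r , a<r , r≤b , sym e

  first-index : ∀ r → a < r → r ≤ b →
    ∃ λ t → t < b ∸ a × nth sorted t ≡ w r × (∀ t' → t' < t → nth sorted t' ≢ w r)
  first-index r a<r r≤b
    with ∈⇒first-index sorted (∈-resp-↭ (↭-sym (sort-↭ values)) (∈-map⁺ w (∈-range⁺ (suc a) b a<r r≤b)))
  ... | t , t< , e , first = t , subst (t <_) length-sorted t< , e , first

  sorted-mono : ∀ {t' t} → t' ≤ t → t < b ∸ a → nth sorted t' ≤ nth sorted t
  sorted-mono t'≤t t< =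
    AllPairs-nth-mono (Linked⇒AllPairs ≤-trans (sort-↗ values)) t'≤t (subst (_ <_) (sym length-sorted) t<)

  ws-block : ∀ {x} → a < x → x ≤ b → ws x ≡ nth sorted (x ∸ suc a)
  ws-block a<x x≤b rewrite ≤ᵇ-true a<x | ≤ᵇ-true x≤b = refl

  ws-outside : ∀ {x} → x ≤ a ⊎ b < x → ws x ≡ w x
  ws-outside {x} (inj₁ x≤a) rewrite ¬-not {suc a ≤ᵇ x} (λ e → <⇒≱ (≤ᵇ-true⁻ e) x≤a) = refl
  ws-outside {x} (inj₂ b<x) with suc a ≤ᵇ x
  ... | false = refl
  ... | true rewrite ¬-not {x ≤ᵇ b} (λ e → <⇒≱ b<x (≤ᵇ-true⁻ e)) = refl

  location : ∀ x → (a < x × x ≤ b) ⊎ (x ≤ a ⊎ b < x)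
  location x with x ≤? a | b <? x
  ... | yes x≤a | _       = inj₂ (inj₁ x≤a)
  ... | no _    | yes b<x = inj₂ (inj₂ b<x)
  ... | no x≰a  | no b≮x  = inj₁ (≰⇒> x≰a , ≮⇒≥ b≮x)

  index< : ∀ {x} → a < x → x ≤ b → x ∸ suc a < b ∸ a
  index< {x} a<x x≤b = ∸-monoˡ-< {x} {suc a} {suc b} (s≤s x≤b) a<x

  ws-block-value : ∀ {x} → a < x → x ≤ b → BlockValue (ws x)
  ws-block-value a<x x≤b with sorted-entry (index< a<x x≤b)
  ... | r , a<r , r≤b , e = r , a<r , r≤b , trans e (sym (ws-block a<x x≤b))

  no-fallen-w : ∀ j → BlockValue j → ∀ i → inFB n w i j ≡ false
  no-fallen-w _ (r , a<r , r≤b , refl) i = top-aligned⇒¬fallen (column n w (w r)) i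
    (top-aligned≤h (w r) (proj₁ (proj₁ perm r (≤-trans (s≤s z≤n) a<r) (≤-trans r≤b b≤n))) (block≤h r a<r r≤b))

  ws-position : ∀ r → a < r → r ≤ b → ∃ λ x₀ → x₀ ≤ b × inv n ws (w r) ≡ x₀ × (∀ x → a < x → x < x₀ → ws x ≤ w r)
  ws-position r a<r r≤b with first-index r a<r r≤b
  ... | t , t< , nth≡wr , first = x₀ , x₀≤b , inv≡x₀ , before
    where
    x₀ : ℕ
    x₀ = suc a + t
    x₀≤b : x₀ ≤ b
    x₀≤b = ≤-trans (≤-reflexive (sym (+-suc a t)))
                   (≤-trans (+-monoʳ-≤ a t<) (≤-reflexive (m+[n∸m]≡n (<⇒≤ (<-≤-trans a<r r≤b)))))
    index-before : ∀ {x} → a < x → x < x₀ → x ∸ suc a < t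
    index-before a<x x<x₀ = subst (_ <_) (m+n∸m≡n (suc a) t) (∸-monoˡ-< x<x₀ a<x)
    before : ∀ x → a < x → x < x₀ → ws x ≤ w r
    before x a<x x<x₀ = ≤-trans (≤-reflexive (ws-block a<x (≤-trans (<⇒≤ x<x₀) x₀≤b)))
      (≤-trans (sorted-mono (<⇒≤ (index-before a<x x<x₀)) t<) (≤-reflexive nth≡wr))
    inv≡x₀ : inv n ws (w r) ≡ x₀
    inv≡x₀ = inv-least (s≤s z≤n) (≤-trans x₀≤b b≤n)
      (trans (ws-block (s≤s (m≤m+n a t)) x₀≤b) (trans (cong (nth sorted) (m+n∸m≡n (suc a) t)) nth≡wr)) earlier
      where
      earlier : ∀ x → 1 ≤ x → x < x₀ → ws x ≢ w r
      earlier x 1≤x x<x₀ e with location x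
      ... | inj₁ (a<x , x≤b) = first (x ∸ suc a) (index-before a<x x<x₀) (trans (sym (ws-block a<x x≤b)) e)
      ... | inj₂ (inj₁ x≤a) = <⇒≱ (h<prefix x 1≤x x≤a)
              (≤-trans (≤-reflexive (trans (sym (ws-outside (inj₁ x≤a))) e)) (block≤h r a<r r≤b))
      ... | inj₂ (inj₂ b<x) = <⇒≱ b<x (≤-trans (<⇒≤ x<x₀) x₀≤b)

  no-fallen-ws : ∀ j → BlockValue j → ∀ i → inFB n ws i j ≡ false
  no-fallen-ws _ (r , a<r , r≤b , refl) i with ws-position r a<r r≤b
  ... | x₀ , x₀≤b , inv≡x₀ , before = top-aligned⇒¬fallen (column n ws (w r)) i top-aligned
    where
    top-aligned : TopAligned (column n ws (w r))
    top-aligned i i' 1≤i' i'≤i e = box⁺ n ws i' (w r)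
      (box 1≤i' (≤-trans i'≤i (Box.row≤n bx)) (Box.col≥1 bx) (Box.col≤n bx) (≤-<-trans i'≤i (Box.row<inv bx))
        (subst (w r <_) (sym (ws-outside (inj₁ i'≤a))) (≤-<-trans (block≤h r a<r r≤b) (h<prefix i' 1≤i' i'≤a))))
      where
      bx : Box n ws i (w r)
      bx = box⁻ n ws i (w r) e
      i<x₀ : i < x₀
      i<x₀ = subst (i <_) inv≡x₀ (Box.row<inv bx)
      i≤a : i ≤ a
      i≤a with location i
      ... | inj₂ (inj₁ i≤a)  = i≤a
      ... | inj₂ (inj₂ b<i)  = ⊥-elim (<⇒≱ b<i (≤-trans (<⇒≤ i<x₀) x₀≤b))
      ... | inj₁ (a<i , _)   = ⊥-elim (<⇒≱ (Box.col<w bx) (before i a<i i<x₀))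
      i'≤a : i' ≤ a
      i'≤a = ≤-trans i'≤i i≤a

  outside-block : ∀ {k} → ¬ BlockValue (w k) → k ≤ a ⊎ b < k
  outside-block {k} not-block with location k
  ... | inj₁ (a<k , k≤b) = ⊥-elim (not-block (k , a<k , k≤b , refl))
  ... | inj₂ outside     = outside

  ws-preimage : ∀ {j x} → ¬ BlockValue j → ws x ≡ j → w x ≡ j
  ws-preimage {x = x} not-block e with location x
  ... | inj₁ (a<x , x≤b) =
          let r , a<r , r≤b , e' = ws-block-value a<x x≤b in ⊥-elim (not-block (r , a<r , r≤b , trans e' e))
  ... | inj₂ outside     = trans (sym (ws-outside outside)) e

  inv-ws : ∀ j → ¬ BlockValue j → inv n ws j ≡ inv n w j
  inv-ws j not-block with inv-cases {n} {w} j
  ... | inj₁ (inv≡0 , absent) =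
          trans (inv-absent λ x 1≤x x≤n → absent x 1≤x x≤n ∘ ws-preimage not-block) (sym inv≡0)
  ... | inj₂ (1≤k , k≤n , wk≡j) = inv-least 1≤k k≤n (trans (ws-outside k-outside) wk≡j) earlier
    where
    k-outside : inv n w j ≤ a ⊎ b < inv n w j
    k-outside = outside-block (subst (¬_ ∘ BlockValue) (sym wk≡j) not-block)
    earlier : ∀ x → 1 ≤ x → x < inv n w j → ws x ≢ j
    earlier x 1≤x x<k e =
      <-irrefl (w-inj x _ 1≤x (≤-trans (<⇒≤ x<k) k≤n) 1≤k k≤n (trans (ws-preimage not-block e) (sym wk≡j))) x<k

  rows-agree : ∀ {j} k → 1 ≤ k → k ≤ n → w k ≡ j → ¬ BlockValue j →
               ∀ i → (j < ws i → j < w i) × (j < w i → j < ws i)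
  rows-agree k 1≤k k≤n refl not-block i with location i
  ... | inj₂ outside = subst (w k <_) (ws-outside outside) , subst (w k <_) (sym (ws-outside outside))
  ... | inj₁ (a<i , i≤b) with ws-block-value a<i i≤b | w k ≤? h
  ...   | r , a<r , r≤b , wr≡wsi | yes wk≤h =
          (λ _ → below-block i a<i i≤b) , (λ _ → subst (w k <_) wr≡wsi (below-block r a<r r≤b))
    where
    below-block : ∀ r → a < r → r ≤ b → w k < w r
    below-block = low-below-block k 1≤k k≤n wk≤h (outside-block not-block)
  ...   | r , a<r , r≤b , wr≡wsi | no wk≰h =
          (λ wk<wsi → ⊥-elim (wk≰h (≤-trans (<⇒≤ wk<wsi) (subst (_≤ h) wr≡wsi (block≤h r a<r r≤b))))) ,
          (λ wk<wi → ⊥-elim (wk≰h (≤-trans (<⇒≤ wk<wi) (block≤h i a<i i≤b))))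

  same-column : ∀ j → ¬ BlockValue j → ∀ i → inD n ws i j ≡ inD n w i j
  same-column j not-block i with inv-cases {n} {w} j
  ... | inj₁ (inv≡0 , _) =
          trans (inD-below-dot n ws i j (subst (_≤ i) (sym (trans (inv-ws j not-block) inv≡0)) z≤n))
                (sym (inD-below-dot n w i j (subst (_≤ i) (sym inv≡0) z≤n)))
  ... | inj₂ (1≤k , k≤n , wk≡j) = inD-≡ n ws w i j
          (λ i<inv' j<wsi → subst (i <_) (inv-ws j not-block) i<inv' , proj₁ agree j<wsi)
          (λ i<inv j<wi → subst (i <_) (sym (inv-ws j not-block)) i<inv , proj₂ agree j<wi)
    where
    agree : (j < ws i → j < w i) × (j < w i → j < ws i)
    agree = rows-agree _ 1≤k k≤n wk≡j not-block i

  block-value? : ∀ j → BlockValue j ⊎ ¬ BlockValue j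
  block-value? j with inv-cases {n} {w} j
  ... | inj₁ (_ , absent) = inj₂ λ (r , a<r , r≤b , e) → absent r (≤-trans (s≤s z≤n) a<r) (≤-trans r≤b b≤n) e
  ... | inj₂ (1≤k , k≤n , wk≡j) with location (inv n w j)
  ...   | inj₁ (a<k , k≤b) = inj₁ (inv n w j , a<k , k≤b , wk≡j)
  ...   | inj₂ outside = inj₂ λ (r , a<r , r≤b , e) → not-there r a<r r≤b
            (w-inj r (inv n w j) (≤-trans (s≤s z≤n) a<r) (≤-trans r≤b b≤n) 1≤k k≤n (trans e (sym wk≡j))) outside
    where
    not-there : ∀ r → a < r → r ≤ b → r ≡ inv n w j → ¬ (inv n w j ≤ a ⊎ b < inv n w j)
    not-there r a<r r≤b refl (inj₁ r≤a) = <⇒≱ a<r r≤a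
    not-there r a<r r≤b refl (inj₂ b<r) = <⇒≱ b<r r≤b

  fallen-boxes-unchanged : ∀ i j → inFB n w i j ≡ inFB n ws i j
  fallen-boxes-unchanged i j with block-value? j
  ... | inj₁ v = trans (no-fallen-w j v i) (sym (no-fallen-ws j v i))
  ... | inj₂ ¬v = sym (fallen-cong (same-column j ¬v) i)

-- The descending cycle

swap-≢ : ∀ {j x} → x ≢ j → x ≢ suc j → swap j x ≡ x
swap-≢ x≢j x≢1+j rewrite ≡ᵇ-false x≢j | ≡ᵇ-false x≢1+j = refl

swap-left : ∀ j → swap j j ≡ suc j
swap-left j rewrite ≡ᵇ-true {j} refl = refl

swap-right : ∀ j → swap j (suc j) ≡ j
swap-right j rewrite ≡ᵇ-false (<⇒≢ (n<1+n j) ∘ sym) | ≡ᵇ-true {j} refl = refl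

module _ (a : ℕ) where

  mulDesc-≤ : ∀ m w {x} → x ≤ a → mulDesc w a m x ≡ w x
  mulDesc-≤ zero    w x≤a = refl
  mulDesc-≤ (suc m) w {x} x≤a = trans (mulDesc-≤ m _ x≤a) (cong w (swap-≢ (<⇒≢ x<) (<⇒≢ (m<n⇒m<1+n x<))))
    where
    x< : x < a + suc m
    x< = ≤-<-trans x≤a (m<m+n a z<s)

  mulDesc-> : ∀ m w {x} → suc (a + m) < x → mulDesc w a m x ≡ w x
  mulDesc-> zero    w a+1<x = refl
  mulDesc-> (suc m) w {x} a+2+m<x =
    trans (mulDesc-> m _ (<-trans (s≤s (≤-reflexive (sym (+-suc a m)))) a+2+m<x))
          (cong w (swap-≢ (<⇒≢ (<-trans (n<1+n _) a+2+m<x) ∘ sym) (<⇒≢ a+2+m<x ∘ sym)))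

  mulDesc-head : ∀ m w → mulDesc w a m (suc a) ≡ w (suc (a + m))
  mulDesc-head zero    w = cong (w ∘ suc) (sym (+-identityʳ a))
  mulDesc-head (suc m) w =
    trans (mulDesc-head m _) (cong w (trans (cong (swap (a + suc m)) (sym (+-suc a m))) (swap-left _)))

  mulDesc-shift : ∀ m w {t} → 1 ≤ t → t ≤ m → mulDesc w a m (suc (a + t)) ≡ w (a + t)
  mulDesc-shift zero    w 1≤t t≤0 = ⊥-elim (<⇒≱ 1≤t t≤0)
  mulDesc-shift (suc m) w {t} 1≤t t≤1+m with m≤n⇒m<n∨m≡n t≤1+m
  ... | inj₁ t<1+m =
          trans (mulDesc-shift m _ 1≤t (s≤s⁻¹ t<1+m)) (cong w (swap-≢ (<⇒≢ a+t<) (<⇒≢ (m<n⇒m<1+n a+t<))))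
    where
    a+t< : a + t < a + suc m
    a+t< = +-monoʳ-< a t<1+m
  ... | inj₂ refl = trans (mulDesc-> m _ (s≤s (≤-reflexive (sym (+-suc a m))))) (cong w (swap-right _))

-- In the paper's notation a = α, a + β = i₁ and c + β = h, so q = i₁ + 1, H = h + 1 is the
-- primary column and w' is wCycle n w.
module Cycle (n : ℕ) (w : ℕ → ℕ) (perm : IsPerm n w) (a β c : ℕ) (1≤β : 1 ≤ β) (q≤n : suc (a + β) ≤ n)
  (block : ∀ t → 1 ≤ t → t ≤ β → w (a + t) ≡ c + t)
  (box-H-above : ∀ i → 1 ≤ i → i ≤ a → inD n w i (suc (c + β)) ≡ true)
  (box-H-q : inD n w (suc (a + β)) (suc (c + β)) ≡ true) where

  q H : ℕ
  q = suc (a + β)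
  H = suc (c + β)

  w' : ℕ → ℕ
  w' = mulDesc w a β

  private
    w-inj : InjectiveOn n w
    w-inj = proj₂ perm

    a<q : a < q
    a<q = s≤s (m≤m+n a β)

    a<a+t : ∀ {t} → 1 ≤ t → a < a + t
    a<a+t = m<m+n a

    1≤a+t : ∀ {t} → 1 ≤ t → 1 ≤ a + t
    1≤a+t 1≤t = ≤-trans 1≤t (m≤n+m _ a)

    a+t<q : ∀ {t} → t ≤ β → a + t < q
    a+t<q t≤β = s≤s (+-monoʳ-≤ a t≤β)

    a+t≤n : ∀ {t} → t ≤ β → a + t ≤ n
    a+t≤n t≤β = ≤-trans (<⇒≤ (a+t<q t≤β)) q≤n

    c+t<H : ∀ {t} → t ≤ β → c + t < H
    c+t<H t≤β = s≤s (+-monoʳ-≤ c t≤β)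

  H<w-q : H < w q
  H<w-q = Box.col<w (box⁻ n w q H box-H-q)

  q<inv-H : q < inv n w H
  q<inv-H = Box.row<inv (box⁻ n w q H box-H-q)

  H<w-above : ∀ i → 1 ≤ i → i ≤ a → H < w i
  H<w-above i 1≤i i≤a = Box.col<w (box⁻ n w i H (box-H-above i 1≤i i≤a))

  data Region (i : ℕ) : Set where
    prefix  : i ≤ a → w' i ≡ w i → Region i
    head    : i ≡ suc a → w' i ≡ w q → Region i
    shifted : ∀ t → 1 ≤ t → t ≤ β → i ≡ suc (a + t) → w' i ≡ w (a + t) → Region i
    suffix  : q < i → w' i ≡ w i → Region i

  region : ∀ i → Region i
  region i with i ≤? a | q <? i
  ... | yes i≤a | _       = prefix i≤a (mulDesc-≤ a β w i≤a)
  ... | no _    | yes q<i = suffix q<i (mulDesc-> a β w q<i)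
  ... | no i≰a  | no q≮i  = inner i (≰⇒> i≰a) (≮⇒≥ q≮i)
    where
    inner : ∀ i → a < i → i ≤ q → Region i
    inner (suc i) (s≤s a≤i) (s≤s i≤a+β) with m≤n⇒m<n∨m≡n a≤i
    ... | inj₂ refl = head refl (mulDesc-head a β w)
    ... | inj₁ a<i with a<x≤a+k⇒x≡a+t a<i i≤a+β
    ...   | t , 1≤t , t≤β , refl = shifted t 1≤t t≤β refl (mulDesc-shift a β w 1≤t t≤β)

  c<w-window : ∀ x → a < x → x ≤ q → c < w x
  c<w-window x a<x x≤q with m≤n⇒m<n∨m≡n x≤q
  ... | inj₂ refl = <-trans (s≤s (m≤m+n c β)) H<w-q
  ... | inj₁ x<q with a<x≤a+k⇒x≡a+t a<x (s≤s⁻¹ x<q)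
  ...   | t , 1≤t , t≤β , refl = subst (c <_) (sym (block t 1≤t t≤β)) (m<m+n c 1≤t)

  c<w'-window : ∀ x → a < x → x ≤ q → c < w' x
  c<w'-window x a<x x≤q with region x
  ... | prefix x≤a _               = ⊥-elim (<⇒≱ a<x x≤a)
  ... | head _ e                   = subst (c <_) (sym e) (c<w-window q a<q ≤-refl)
  ... | shifted t 1≤t t≤β _ e      = subst (c <_) (sym e) (c<w-window (a + t) (a<a+t 1≤t) (<⇒≤ (a+t<q t≤β)))
  ... | suffix q<x _               = ⊥-elim (<⇒≱ q<x x≤q)

  inv'-block : ∀ t → 1 ≤ t → t ≤ β → inv n w' (c + t) ≡ suc (a + t)
  inv'-block t 1≤t t≤β = inv-least (s≤s z≤n) (≤-trans (a+t<q t≤β) q≤n)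
    (trans (mulDesc-shift a β w 1≤t t≤β) (block t 1≤t t≤β)) earlier
    where
    earlier : ∀ i → 1 ≤ i → i < suc (a + t) → w' i ≢ c + t
    earlier i 1≤i i< e with region i
    ... | prefix i≤a e' = <⇒≱ (a<a+t 1≤t) (≤-trans (≤-reflexive (sym i≡a+t)) i≤a)
      where
      i≡a+t : i ≡ a + t
      i≡a+t = w-inj i (a + t) 1≤i (≤-trans i≤a (<⇒≤ (≤-trans (a<a+t 1≤t) (a+t≤n t≤β))))
                (1≤a+t 1≤t) (a+t≤n t≤β) (trans (sym e') (trans e (sym (block t 1≤t t≤β))))
    ... | head _ e' = <⇒≱ (<-trans (c+t<H t≤β) H<w-q) (≤-reflexive (trans (sym e') e))
    ... | shifted t' 1≤t' t'≤β refl e' =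
            <-irrefl (cong (λ s → suc (a + s))
                           (+-cancelˡ-≡ c t' t (trans (sym (block t' 1≤t' t'≤β)) (trans (sym e') e)))) i<
    ... | suffix q<i _ = <⇒≱ i< (≤-trans (s≤s (<⇒≤ (a+t<q t≤β))) q<i)

  Unmoved : ℕ → Set
  Unmoved x = x ≤ a ⊎ q < x

  w'-unmoved : ∀ {x} → Unmoved x → w' x ≡ w x
  w'-unmoved (inj₁ x≤a) = mulDesc-≤ a β w x≤a
  w'-unmoved (inj₂ q<x) = mulDesc-> a β w q<x

  inv'-unmoved : ∀ x → 1 ≤ x → x ≤ n → Unmoved x → inv n w' (w x) ≡ x
  inv'-unmoved x 1≤x x≤n unmoved = inv-least 1≤x x≤n (w'-unmoved unmoved) (earlier unmoved)
    where
    same-row : ∀ {y} → 1 ≤ y → y ≤ n → w y ≡ w x → y ≡ x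
    same-row 1≤y y≤n = w-inj _ x 1≤y y≤n 1≤x x≤n
    earlier : Unmoved x → ∀ i → 1 ≤ i → i < x → w' i ≢ w x
    earlier side i 1≤i i<x e with region i
    ... | prefix _ e' = <-irrefl (same-row 1≤i (≤-trans (<⇒≤ i<x) x≤n) (trans (sym e') e)) i<x
    ... | suffix _ e' = <-irrefl (same-row 1≤i (≤-trans (<⇒≤ i<x) x≤n) (trans (sym e') e)) i<x
    ... | head _ e' with same-row (s≤s z≤n) q≤n (trans (sym e') e) | side
    ...   | refl | inj₁ x≤a = <⇒≱ a<q x≤a
    ...   | refl | inj₂ q<x = <-irrefl refl q<x
    earlier side i 1≤i i<x e | shifted t 1≤t t≤β _ e'
      with same-row (1≤a+t 1≤t) (a+t≤n t≤β) (trans (sym e') e) | side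
    ...   | refl | inj₁ x≤a = <⇒≱ (a<a+t 1≤t) x≤a
    ...   | refl | inj₂ q<x = <-asym q<x (a+t<q t≤β)

  inv'-head : inv n w' (w q) ≡ suc a
  inv'-head = inv-least (s≤s z≤n) (≤-trans a<q q≤n) (mulDesc-head a β w) earlier
    where
    earlier : ∀ i → 1 ≤ i → i < suc a → w' i ≢ w q
    earlier i 1≤i (s≤s i≤a) e = <⇒≱ a<q (≤-trans (≤-reflexive (sym i≡q)) i≤a)
      where
      i≡q : i ≡ q
      i≡q = w-inj i q 1≤i (≤-trans i≤a (≤-trans (<⇒≤ a<q) q≤n)) (s≤s z≤n) q≤n (trans (sym (mulDesc-≤ a β w i≤a)) e)

  w'-values : ∀ i → 1 ≤ i → i ≤ n → ∃ λ x → 1 ≤ x × x ≤ n × w' i ≡ w x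
  w'-values i 1≤i i≤n with region i
  ... | prefix _ e            = i , 1≤i , i≤n , e
  ... | head _ e              = q , s≤s z≤n , q≤n , e
  ... | shifted t 1≤t t≤β _ e = a + t , 1≤a+t 1≤t , a+t≤n t≤β , e
  ... | suffix _ e            = i , 1≤i , i≤n , e

  Unchanged : ℕ → Set
  Unchanged j = ∀ i → inD n w' i j ≡ inD n w i j

  unchanged-absent : ∀ j → inv n w j ≡ 0 → (∀ x → 1 ≤ x → x ≤ n → w x ≢ j) → Unchanged j
  unchanged-absent j inv≡0 absent i =
    trans (inD-below-dot n w' i j (subst (_≤ i) (sym inv'≡0) z≤n))
          (sym (inD-below-dot n w i j (subst (_≤ i) (sym inv≡0) z≤n)))
    where
    inv'≡0 : inv n w' j ≡ 0
    inv'≡0 = inv-absent λ i 1≤i i≤n e → let x , 1≤x , x≤n , e' = w'-values i 1≤i i≤n in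
      absent x 1≤x x≤n (trans (sym e') e)

  unchanged-unmoved-row : ∀ k → 1 ≤ k → k ≤ n → Unmoved k →
    (∀ i → a < i → i ≤ q → i < k → (w k < w' i → w k < w i) × (w k < w i → w k < w' i)) → Unchanged (w k)
  unchanged-unmoved-row k 1≤k k≤n unmoved window i =
    inD-≡ n w' w i (w k)
      (λ i<inv' wk<w'i → let i<k = subst (i <_) inv'≡k i<inv' in
         subst (i <_) (sym inv≡k) i<k , proj₁ (row-agrees i i<k) wk<w'i)
      (λ i<inv wk<wi → let i<k = subst (i <_) inv≡k i<inv in
         subst (i <_) (sym inv'≡k) i<k , proj₂ (row-agrees i i<k) wk<wi)
    where
    inv'≡k : inv n w' (w k) ≡ k
    inv'≡k = inv'-unmoved k 1≤k k≤n unmoved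
    inv≡k : inv n w (w k) ≡ k
    inv≡k = inv-value w-inj 1≤k k≤n
    row-agrees : ∀ i → i < k → (w k < w' i → w k < w i) × (w k < w i → w k < w' i)
    row-agrees i i<k with i ≤? a | q <? i
    ... | yes i≤a | _       = let e = w'-unmoved (inj₁ i≤a) in subst (w k <_) e , subst (w k <_) (sym e)
    ... | no _    | yes q<i = let e = w'-unmoved (inj₂ q<i) in subst (w k <_) e , subst (w k <_) (sym e)
    ... | no i≰a  | no q≮i  = window i (≰⇒> i≰a) (≮⇒≥ q≮i) i<k

  unchanged-prefix : ∀ k → 1 ≤ k → k ≤ a → Unchanged (w k)
  unchanged-prefix k 1≤k k≤a = unchanged-unmoved-row k 1≤k (≤-trans k≤a (≤-trans (<⇒≤ a<q) q≤n)) (inj₁ k≤a)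
    (λ i a<i _ i<k → ⊥-elim (<⇒≱ (<-trans a<i i<k) k≤a))

  unchanged-low : ∀ k → q < k → k ≤ n → w k ≤ c → Unchanged (w k)
  unchanged-low k q<k k≤n wk≤c = unchanged-unmoved-row k (≤-trans (s≤s z≤n) (<⇒≤ q<k)) k≤n (inj₂ q<k)
    (λ i a<i i≤q _ → (λ _ → ≤-<-trans wk≤c (c<w-window i a<i i≤q)) ,
                     (λ _ → ≤-<-trans wk≤c (c<w'-window i a<i i≤q)))

  unchanged-q : Unchanged (w q)
  unchanged-q i = inD-≡ n w' w i (w q)
    (λ i<inv' wq<w'i → let i≤a = s≤s⁻¹ (subst (i <_) inv'-head i<inv') in
       subst (i <_) (sym inv≡q) (≤-<-trans i≤a a<q) , subst (w q <_) (mulDesc-≤ a β w i≤a) wq<w'i)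
    (λ i<inv wq<wi → above-q (subst (i <_) inv≡q i<inv) wq<wi)
    where
    inv≡q : inv n w (w q) ≡ q
    inv≡q = inv-value w-inj (s≤s z≤n) q≤n
    above-q : i < q → w q < w i → i < inv n w' (w q) × w q < w' i
    above-q i<q wq<wi with i ≤? a
    ... | yes i≤a = subst (i <_) (sym inv'-head) (s≤s i≤a) , subst (w q <_) (sym (mulDesc-≤ a β w i≤a)) wq<wi
    ... | no i≰a with a<x≤a+k⇒x≡a+t (≰⇒> i≰a) (s≤s⁻¹ i<q)
    ...   | t , 1≤t , t≤β , refl =
            ⊥-elim (<-asym wq<wi (subst (_< w q) (sym (block t 1≤t t≤β)) (<-trans (c+t<H t≤β) H<w-q)))

  block-column-top-aligned' : ∀ t → 1 ≤ t → t ≤ β → TopAligned (column n w' (c + t))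
  block-column-top-aligned' t 1≤t t≤β i i' 1≤i' i'≤i e = box⁺ n w' i' (c + t)
    (box 1≤i' (≤-trans i'≤i (Box.row≤n b)) (Box.col≥1 b) (Box.col≤n b) (≤-<-trans i'≤i (Box.row<inv b))
      (above-head (≤-trans i'≤i i≤1+a)))
    where
    b : Box n w' i (c + t)
    b = box⁻ n w' i (c + t) e
    i<1+a+t : i < suc (a + t)
    i<1+a+t = subst (i <_) (inv'-block t 1≤t t≤β) (Box.row<inv b)
    i≤1+a : i ≤ suc a
    i≤1+a with region i
    ... | prefix i≤a _ = m≤n⇒m≤1+n i≤a
    ... | head refl _  = ≤-refl
    ... | shifted t' 1≤t' t'≤β refl e' = ⊥-elim (<⇒≱ (Box.col<w b)
            (≤-trans (≤-reflexive (trans e' (block t' 1≤t' t'≤β)))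
                     (+-monoʳ-≤ c (<⇒≤ (+-cancelˡ-< a t' t (s≤s⁻¹ i<1+a+t))))))
    ... | suffix q<i _ = ⊥-elim (<⇒≱ i<1+a+t (≤-trans (a+t<q t≤β) (<⇒≤ q<i)))
    above-head : i' ≤ suc a → c + t < w' i'
    above-head i'≤1+a with m≤n⇒m<n∨m≡n i'≤1+a
    ... | inj₁ (s≤s i'≤a) =
            subst (c + t <_) (sym (mulDesc-≤ a β w i'≤a)) (<-trans (c+t<H t≤β) (H<w-above i' 1≤i' i'≤a))
    ... | inj₂ refl       = subst (c + t <_) (sym (mulDesc-head a β w)) (<-trans (c+t<H t≤β) H<w-q)

  module Raised (j k : ℕ) (inv≡k : inv n w j ≡ k) (q<k : q < k) (k≤n : k ≤ n) (wk≡j : w k ≡ j)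
                (c+β<j : c + β < j) where

    private
      inv'≡inv : inv n w' j ≡ inv n w j
      inv'≡inv = trans (subst (λ v → inv n w' v ≡ k) wk≡j
                                (inv'-unmoved k (≤-trans (s≤s z≤n) (<⇒≤ q<k)) k≤n (inj₂ q<k)))
                       (sym inv≡k)

      same-above : ∀ i → i < suc a → column n w' j i ≡ column n w j i
      same-above i (s≤s i≤a) = inD-cong n w' w i j inv'≡inv (mulDesc-≤ a β w i≤a)

      same-below : ∀ i → q < i → column n w' j i ≡ column n w j i
      same-below i q<i = inD-cong n w' w i j inv'≡inv (mulDesc-> a β w q<i)

      empty-from-p : ∀ i → suc a ≤ i → i < q → column n w j i ≡ false
      empty-from-p i a<i (s≤s i≤a+β) with a<x≤a+k⇒x≡a+t a<i i≤a+β
      ... | t , 1≤t , t≤β , refl = no-box n w (a + t) j λ b →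
            <⇒≱ (Box.col<w b) (≤-trans (≤-reflexive (block t 1≤t t≤β)) (≤-trans (+-monoʳ-≤ c t≤β) (<⇒≤ c+β<j)))

      empty-to-q : ∀ i → suc a < i → i ≤ q → column n w' j i ≡ false
      empty-to-q i 1+a<i i≤q = no-box n w' i j λ b → small (Box.col<w b)
        where
        small : j < w' i → ⊥
        small j<w'i with region i
        ... | prefix i≤a _ = <⇒≱ 1+a<i (m≤n⇒m≤1+n i≤a)
        ... | head refl _  = <-irrefl refl 1+a<i
        ... | shifted t 1≤t t≤β _ e = <⇒≱ j<w'i
                (≤-trans (≤-reflexive (trans e (block t 1≤t t≤β))) (≤-trans (+-monoʳ-≤ c t≤β) (<⇒≤ c+β<j)))
        ... | suffix q<i _ = <⇒≱ q<i i≤q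

      moved : column n w' j (suc a) ≡ column n w j q
      moved = Bool-ext
        (λ e → let b = box⁻ n w' (suc a) j e in box⁺ n w q j
          (box (s≤s z≤n) q≤n (Box.col≥1 b) (Box.col≤n b) (subst (q <_) (sym inv≡k) q<k)
               (subst (j <_) (mulDesc-head a β w) (Box.col<w b))))
        (λ e → let b = box⁻ n w q j e in box⁺ n w' (suc a) j
          (box (s≤s z≤n) (≤-trans a<q q≤n) (Box.col≥1 b) (Box.col≤n b)
               (subst (suc a <_) (sym (trans inv'≡inv inv≡k)) (≤-<-trans a<q q<k))
               (subst (j <_) (sym (mulDesc-head a β w)) (Box.col<w b))))

    open RaisedBox (column n w j) (column n w' j) (s≤s z≤n) (s≤s (a<a+t 1≤β))
                   same-above same-below empty-from-p empty-to-q moved public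

  data Kind (j : ℕ) : Set where
    unchanged   : Unchanged j → Kind j
    block-value : ∀ t → 1 ≤ t → t ≤ β → j ≡ c + t → Kind j
    raised      : ∀ k → inv n w j ≡ k → q < k → k ≤ n → w k ≡ j → c + β < j → Kind j

  kind : ∀ j → Kind j
  kind j with inv-cases j
  ... | inj₁ (inv≡0 , absent) = unchanged (unchanged-absent j inv≡0 absent)
  ... | inj₂ (1≤k , k≤n , wk≡j) with inv n w j ≤? a
  ...   | yes k≤a = unchanged (subst Unchanged wk≡j (unchanged-prefix _ 1≤k k≤a))
  ...   | no k≰a with inv n w j ≤? a + β
  ...     | yes k≤a+β = let t , 1≤t , t≤β , k≡a+t = a<x≤a+k⇒x≡a+t (≰⇒> k≰a) k≤a+β in
                        block-value t 1≤t t≤β (trans (sym wk≡j) (trans (cong w k≡a+t) (block t 1≤t t≤β)))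
  ...     | no k≰a+β with inv n w j ≟ q
  ...       | yes k≡q = unchanged (subst Unchanged (trans (cong w (sym k≡q)) wk≡j) unchanged-q)
  ...       | no k≢q with ≤∧≢⇒< (≰⇒> k≰a+β) (k≢q ∘ sym) | j ≤? c
  ...         | q<k | yes j≤c =
                  unchanged (subst Unchanged wk≡j (unchanged-low _ q<k k≤n (subst (_≤ c) (sym wk≡j) j≤c)))
  ...         | q<k | no j≰c  = raised _ refl q<k k≤n wk≡j (≰⇒> c+β≱j)
    where
    c+β≱j : ¬ (j ≤ c + β)
    c+β≱j j≤c+β = let t , 1≤t , t≤β , j≡c+t = a<x≤a+k⇒x≡a+t (≰⇒> j≰c) j≤c+β in
      k≰a+β (≤-trans (≤-reflexive (w-inj _ (a + t) 1≤k k≤n (1≤a+t 1≤t) (a+t≤n t≤β)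
        (trans wk≡j (trans j≡c+t (sym (block t 1≤t t≤β)))))) (+-monoʳ-≤ a t≤β))

  countFB-decreases : countFB n w' < countFB n w
  countFB-decreases = countFB-< n w w' (s≤s z≤n) p<q q≤n off-pq pair (s≤s z≤n) H≤n strict
    where
    p<q : suc a < q
    p<q = s≤s (a<a+t 1≤β)

    H≤n : H ≤ n
    H≤n = Box.col≤n (box⁻ n w q H box-H-q)

    block-columns-no-fallen' : ∀ t → 1 ≤ t → t ≤ β → ∀ i → inFB n w' i (c + t) ≡ false
    block-columns-no-fallen' t 1≤t t≤β i =
      top-aligned⇒¬fallen (column n w' (c + t)) i (block-column-top-aligned' t 1≤t t≤β)

    off-pq : ∀ i j → i ≢ suc a → i ≢ q → inFB n w' i j ≡ true → inFB n w i j ≡ true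
    off-pq i j i≢p i≢q e with kind j
    ... | unchanged same = trans (sym (fallen-cong same i)) e
    ... | block-value t 1≤t t≤β refl = ⊥-elim (not-¬ e (block-columns-no-fallen' t 1≤t t≤β i))
    ... | raised k inv≡k q<k k≤n wk≡j c+β<j = Raised.fallen-off-pq j k inv≡k q<k k≤n wk≡j c+β<j i i≢p i≢q e

    pair : ∀ j → pairFB n w' (suc a) q j ≤ pairFB n w (suc a) q j
    pair j with kind j
    ... | unchanged same =
            ≤-reflexive (cong₂ _+_ (cong indicator (fallen-cong same (suc a))) (cong indicator (fallen-cong same q)))
    ... | block-value t 1≤t t≤β refl =
            subst (_≤ pairFB n w (suc a) q (c + t))
                  (sym (cong₂ _+_ (cong indicator (block-columns-no-fallen' t 1≤t t≤β (suc a)))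
                                  (cong indicator (block-columns-no-fallen' t 1≤t t≤β q))))
                  z≤n
    ... | raised k inv≡k q<k k≤n wk≡j c+β<j = Raised.pair-≤ j k inv≡k q<k k≤n wk≡j c+β<j

    strict : pairFB n w' (suc a) q H < pairFB n w (suc a) q H
    strict with inv-cases {n} {w} H
    ... | inj₁ (inv≡0 , _) = ⊥-elim (<⇒≱ q<inv-H (subst (_≤ q) (sym inv≡0) z≤n))
    ... | inj₂ (_ , k≤n , wk≡H) = Raised.pair-< H _ refl q<inv-H k≤n wk≡H ≤-refl
            (λ i 1≤i i<1+a → box-H-above i 1≤i (s≤s⁻¹ i<1+a)) box-H-q

-- Primary column data

standard⇒top-aligned : ∀ n w j → isStdCol n w j ≡ true → TopAligned (column n w j)
standard⇒top-aligned n w j std i i' 1≤i' i'≤i e with any-range⁻ _ 0 n std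
... | k , _ , _ , col≡[k] = trans (beq-true⁻ (agrees i' 1≤i' (≤-trans i'≤i i≤n))) (≤ᵇ-true (≤-trans i'≤i i≤k))
  where
  i≤n : i ≤ n
  i≤n = Box.row≤n (box⁻ n w i j e)
  agrees : ∀ i → 1 ≤ i → i ≤ n → beq (inD n w i j) (i ≤ᵇ k) ≡ true
  agrees = all-range⁻ _ 1 n col≡[k]
  i≤k : i ≤ k
  i≤k = ≤ᵇ-true⁻ (trans (sym (beq-true⁻ (agrees i (≤-trans 1≤i' i'≤i) i≤n))) e)

false-propagates : ∀ (C : ℕ → Bool) {s e} → C s ≡ false → (∀ z → s ≤ z → z < e → C z ≡ false → C (suc z) ≡ false) →
                   ∀ z → s ≤ z → z ≤ e → C z ≡ false
false-propagates C {s} {e} Cs step z s≤z z≤e = go (z ∸ s) z (m∸n+n≡m s≤z) z≤e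
  where
  go : ∀ d z → d + s ≡ z → z ≤ e → C z ≡ false
  go zero    z refl _   = Cs
  go (suc d) z refl z≤e = step (d + s) (m≤n+m s d) z≤e (go d (d + s) refl (≤-trans (n≤1+n _) z≤e))

module PrimaryData (n : ℕ) (w : ℕ → ℕ) (perm : IsPerm n w) where

  private
    w-inj : InjectiveOn n w
    w-inj = proj₂ perm

  α : ℕ
  α = primα n w

  α-spec : all (inC n w) (range 1 α) ≡ true × α ≤ n × (∀ z → z ≤ n → α < z → all (inC n w) (range 1 z) ≡ false)
  α-spec = findLast-range-from-0 (λ a → all (inC n w) (range 1 a)) n refl

  α-full : ∀ i → 1 ≤ i → i ≤ α → inC n w i ≡ true
  α-full = all-range⁻ (inC n w) 1 α (proj₁ α-spec)

  α≤n : α ≤ n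
  α≤n = proj₁ (proj₂ α-spec)

  α-maximal : ∀ z → z ≤ n → α < z → all (inC n w) (range 1 z) ≡ false
  α-maximal = proj₂ (proj₂ α-spec)

  module Dominant (dom : isDominant n w ≡ true) where

    h≡n : primH n w ≡ n
    h≡n = if-true dom

    i₁≡n : primI1 n w ≡ n
    i₁≡n = if-true dom

    α≡0 : α ≡ 0
    α≡0 = n≤0⇒n≡0 (≮⇒≥ λ 0<α → not-¬ (α-full 1 ≤-refl 0<α) (if-true dom))

    fallen-boxes-unchanged : ∀ i j → inFB n w i j ≡ inFB n (wsort n w) i j
    fallen-boxes-unchanged = Sorting.fallen-boxes-unchanged n w perm α (primI1 n w) (primH n w)
      (≤-reflexive i₁≡n) block≤h h<prefix top-aligned low-below-block
      where
      block≤h : ∀ x → α < x → x ≤ primI1 n w → w x ≤ primH n w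
      block≤h x α<x x≤i₁ =
        ≤-trans (proj₂ (proj₁ perm x (≤-trans (s≤s z≤n) α<x) (≤-trans x≤i₁ (≤-reflexive i₁≡n))))
                (≤-reflexive (sym h≡n))
      h<prefix : ∀ i → 1 ≤ i → i ≤ α → primH n w < w i
      h<prefix i 1≤i i≤α = ⊥-elim (<⇒≱ 1≤i (≤-trans i≤α (≤-reflexive α≡0)))
      top-aligned : ∀ j → 1 ≤ j → j ≤ primH n w → TopAligned (column n w j)
      top-aligned j 1≤j j≤h =
        standard⇒top-aligned n w j (all-range⁻ (isStdCol n w) 1 n dom j 1≤j (≤-trans j≤h (≤-reflexive h≡n)))
      low-below-block : ∀ k → 1 ≤ k → k ≤ n → w k ≤ primH n w → k ≤ α ⊎ primI1 n w < k →
                        ∀ r → α < r → r ≤ primI1 n w → w k < w r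
      low-below-block k 1≤k k≤n _ (inj₁ k≤α)  = ⊥-elim (<⇒≱ 1≤k (≤-trans k≤α (≤-reflexive α≡0)))
      low-below-block k 1≤k k≤n _ (inj₂ i₁<k) = ⊥-elim (<⇒≱ i₁<k (≤-trans k≤n (≤-reflexive (sym i₁≡n))))

    sorted⇒identity : IsSorted n w → IsIdentity n w
    sorted⇒identity sorted i 1≤i i≤n =
      trans (cong₂ (λ A C → w (A + i) ∸ C) (sym α≡0) (sym shift≡0))
            (sorted i 1≤i (≤-trans i≤n (≤-reflexive (sym β≡n))))
      where
      β≡n : primβ n w ≡ n
      β≡n = cong₂ _∸_ i₁≡n α≡0
      shift≡0 : primH n w ∸ primβ n w ≡ 0
      shift≡0 = trans (cong₂ _∸_ h≡n β≡n) (n∸n≡0 n)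

  module NonDominant (nd : isDominant n w ≡ false) where

    h : ℕ
    h = primH n w

    C : ℕ → Bool
    C i = inD n w i (suc h)

    inC≡C : ∀ i → inC n w i ≡ C i
    inC≡C i = if-false nd

    first-nonstandard : LeastIn (λ j → not (isStdCol n w j)) 1 n (suc h)
    first-nonstandard with findFirst-range (λ j → not (isStdCol n w j)) (suc n) 1 n
    ... | inj₂ (none , _) =
            ⊥-elim (not-¬ (all-range⁺ (isStdCol n w) 1 n λ j 1≤j j≤n → not-injective (none j 1≤j j≤n)) nd)
    ... | inj₁ least = subst (LeastIn _ 1 n) (sym 1+h≡) least
      where
      1+h≡ : suc h ≡ findFirst (λ j → not (isStdCol n w j)) (suc n) (range 1 n)
      1+h≡ = trans (cong suc (if-false nd)) (suc-pred _ {{>-nonZero (LeastIn.lower least)}})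

    1+h≤n : suc h ≤ n
    1+h≤n = LeastIn.upper first-nonstandard

    standard-below : ∀ j → 1 ≤ j → j ≤ h → isStdCol n w j ≡ true
    standard-below j 1≤j j≤h = not-injective (LeastIn.least first-nonstandard j 1≤j (s≤s j≤h))

    C-α-full : ∀ i → 1 ≤ i → i ≤ α → C i ≡ true
    C-α-full i 1≤i i≤α = trans (sym (inC≡C i)) (α-full i 1≤i i≤α)

    C-after-α : C (suc α) ≡ false
    C-after-α with suc α ≤? n
    ... | no 1+α≰n = no-box n w (suc α) (suc h) (1+α≰n ∘ Box.row≤n)
    ... | yes 1+α≤n =
            ¬-not λ C1+α → not-¬ (all-range⁺ (inC n w) 1 (suc α) (full C1+α)) (α-maximal (suc α) 1+α≤n ≤-refl)
      where
      full : C (suc α) ≡ true → ∀ i → 1 ≤ i → i ≤ suc α → inC n w i ≡ true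
      full C1+α i 1≤i i≤1+α with m≤n⇒m<n∨m≡n i≤1+α
      ... | inj₁ (s≤s i≤α) = α-full i 1≤i i≤α
      ... | inj₂ refl      = trans (inC≡C (suc α)) C1+α

    Tooth : ℕ → Bool
    Tooth i = not (inC n w i) ∧ inC n w (suc i)

    no-tooth : ∀ {z} → Tooth z ≡ false → C z ≡ false → C (suc z) ≡ false
    no-tooth {z} ¬tooth Cz =
      trans (sym (inC≡C (suc z))) (subst (λ b → not b ∧ inC n w (suc z) ≡ false) (trans (inC≡C z) Cz) ¬tooth)

    tooth : LeastIn Tooth 1 n (primI1 n w)
    tooth with findFirst-range Tooth n 1 n
    ... | inj₁ least = subst (LeastIn Tooth 1 n) (sym (if-false nd)) least
    ... | inj₂ (none , _) = ⊥-elim (not-¬ standard (not-injective (LeastIn.holds first-nonstandard)))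
      where
      empty-after-α : ∀ i → suc α ≤ i → i ≤ n → C i ≡ false
      empty-after-α = false-propagates C C-after-α
        λ z 1+α≤z z<n → no-tooth (none z (≤-trans (s≤s z≤n) 1+α≤z) (<⇒≤ z<n))
      standard : isStdCol n w (suc h) ≡ true
      standard = any-range⁺ _ 0 n α z≤n α≤n (all-range⁺ _ 1 n λ i 1≤i i≤n → beq-true (column≡[α] i 1≤i i≤n))
        where
        column≡[α] : ∀ i → 1 ≤ i → i ≤ n → C i ≡ (i ≤ᵇ α)
        column≡[α] i 1≤i i≤n with i ≤? α
        ... | yes i≤α = trans (C-α-full i 1≤i i≤α) (sym (≤ᵇ-true i≤α))
        ... | no i≰α  = trans (empty-after-α i (≰⇒> i≰α) i≤n) (sym (¬-not (i≰α ∘ ≤ᵇ-true⁻)))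

    i₁ : ℕ
    i₁ = primI1 n w

    C-i₁ : C i₁ ≡ false
    C-i₁ = trans (sym (inC≡C i₁)) (not-injective (proj₁ (∧-true⁻ (LeastIn.holds tooth))))

    C-1+i₁ : C (suc i₁) ≡ true
    C-1+i₁ = trans (sym (inC≡C (suc i₁))) (proj₂ (∧-true⁻ (LeastIn.holds tooth)))

    α<i₁ : α < i₁
    α<i₁ = ≰⇒> λ i₁≤α → not-¬ (C-α-full i₁ (LeastIn.lower tooth) i₁≤α) C-i₁

    empty-block : ∀ i → α < i → i ≤ i₁ → C i ≡ false
    empty-block = false-propagates C C-after-α
      λ z α<z z<i₁ → no-tooth (LeastIn.least tooth z (≤-trans (s≤s z≤n) α<z) z<i₁)

    box-1+i₁ : Box n w (suc i₁) (suc h)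
    box-1+i₁ = box⁻ n w (suc i₁) (suc h) C-1+i₁

    block≤h : ∀ x → α < x → x ≤ i₁ → w x ≤ h
    block≤h x α<x x≤i₁ with <-cmp (w x) (suc h)
    ... | tri< wx<1+h _ _ = s≤s⁻¹ wx<1+h
    ... | tri≈ _ wx≡1+h _ = ⊥-elim (<⇒≱ (Box.row<inv box-1+i₁)
            (≤-trans (≤-reflexive (trans (cong (inv n w) (sym wx≡1+h)) (inv-value w-inj 1≤x x≤n)))
                     (m≤n⇒m≤1+n x≤i₁)))
      where
      1≤x : 1 ≤ x
      1≤x = ≤-trans (s≤s z≤n) α<x
      x≤n : x ≤ n
      x≤n = ≤-trans x≤i₁ (LeastIn.upper tooth)
    ... | tri> _ _ 1+h<wx = ⊥-elim (not-¬ (box⁺ n w x (suc h)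
            (box (≤-trans (s≤s z≤n) α<x) (≤-trans x≤i₁ (LeastIn.upper tooth)) (s≤s z≤n) 1+h≤n
                 (<-trans (s≤s x≤i₁) (Box.row<inv box-1+i₁)) 1+h<wx)) (empty-block x α<x x≤i₁))

    h<prefix : ∀ i → 1 ≤ i → i ≤ α → h < w i
    h<prefix i 1≤i i≤α = <-trans (n<1+n h) (Box.col<w (box⁻ n w i (suc h) (C-α-full i 1≤i i≤α)))

    top-aligned≤h : ∀ j → 1 ≤ j → j ≤ h → TopAligned (column n w j)
    top-aligned≤h j 1≤j j≤h = standard⇒top-aligned n w j (standard-below j 1≤j j≤h)

    low-below-block : ∀ k → 1 ≤ k → k ≤ n → w k ≤ h → k ≤ α ⊎ i₁ < k → ∀ r → α < r → r ≤ i₁ → w k < w r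
    low-below-block k 1≤k k≤n wk≤h (inj₁ k≤α) r _ _ = ⊥-elim (<⇒≱ (h<prefix k 1≤k k≤α) wk≤h)
    low-below-block k 1≤k k≤n wk≤h (inj₂ i₁<k) r α<r r≤i₁ with k ≟ suc i₁
    ... | yes refl = ⊥-elim (<⇒≱ (<-trans (s≤s wk≤h) (Box.col<w box-1+i₁)) ≤-refl)
    ... | no k≢1+i₁ = Box.col<w (box⁻ n w r (w k)
            (top-aligned≤h (w k) 1≤wk wk≤h (suc i₁) r (≤-trans (s≤s z≤n) α<r) (m≤n⇒m≤1+n r≤i₁) box-in-row-1+i₁))
      where
      1≤wk : 1 ≤ w k
      1≤wk = proj₁ (proj₁ perm k 1≤k k≤n)
      box-in-row-1+i₁ : inD n w (suc i₁) (w k) ≡ true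
      box-in-row-1+i₁ = box⁺ n w (suc i₁) (w k)
        (box (s≤s z≤n) (Box.row≤n box-1+i₁) 1≤wk (≤-trans wk≤h (≤-trans (n≤1+n h) 1+h≤n))
             (subst (suc i₁ <_) (sym (inv-value w-inj 1≤k k≤n)) (≤∧≢⇒< i₁<k (k≢1+i₁ ∘ sym)))
             (<-trans (s≤s wk≤h) (Box.col<w box-1+i₁)))

    fallen-boxes-unchanged : ∀ i j → inFB n w i j ≡ inFB n (wsort n w) i j
    fallen-boxes-unchanged = Sorting.fallen-boxes-unchanged n w perm α i₁ h (LeastIn.upper tooth)
      block≤h h<prefix top-aligned≤h low-below-block

    β c : ℕ
    β = primβ n w
    c = h ∸ β

    1≤β : 1 ≤ β
    1≤β = m<n⇒0<n∸m α<i₁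

    α+β≡i₁ : α + β ≡ i₁
    α+β≡i₁ = m+[n∸m]≡n (<⇒≤ α<i₁)

    module _ (sorted : IsSorted n w) where

      block : ∀ t → 1 ≤ t → t ≤ β → w (α + t) ≡ c + t
      block t 1≤t t≤β = m∸n≡o⇒m≡n+o 1≤t (sorted t 1≤t t≤β)

      c+β≡h : c + β ≡ h
      c+β≡h = m∸n+n≡m (≤-trans (m≤n+m β c)
        (≤-trans (≤-reflexive (trans (sym (block β 1≤β ≤-refl)) (cong w α+β≡i₁))) (block≤h i₁ α<i₁ ≤-refl)))

      cycle-decreases : countFB n (wCycle n w) < countFB n w
      cycle-decreases = Cycle.countFB-decreases n w perm α β c 1≤β
        (subst (λ y → suc y ≤ n) (sym α+β≡i₁) (Box.row≤n box-1+i₁)) block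
        (λ i 1≤i i≤α → subst (λ y → inD n w i (suc y) ≡ true) (sym c+β≡h) (C-α-full i 1≤i i≤α))
        (subst₂ (λ x y → inD n w (suc x) (suc y) ≡ true) (sym α+β≡i₁) (sym c+β≡h) C-1+i₁)

lemma5p3 : (n : ℕ) → (w : ℕ → ℕ) → IsPerm n w →
    ((∀ i j → inFB n w i j ≡ inFB n (wsort n w) i j) ×
     (¬ IsIdentity n w → IsSorted n w → countFB n (wCycle n w) < countFB n w))
lemma5p3 n w perm with true-or-false (isDominant n w)
... | inj₁ dom = fallen-boxes-unchanged , λ ¬id sorted → ⊥-elim (¬id (sorted⇒identity sorted))
  where open PrimaryData.Dominant n w perm dom
... | inj₂ nd  = fallen-boxes-unchanged , λ _ → cycle-decreases
  where open PrimaryData.NonDominant n w perm nd
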